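{- If a signed series-parallel graph $G'$ is of series type and both of its endparts are unbalanced, then every edge of $G'$ is contained in a barbell.
   Context: A signed graph is a loopless graph (parallel edges allowed) with each edge labelled positive or negative. A cycle is balanced if it has an even number of negative edges and unbalanced otherwise; a signed graph is unbalanced if it contains an unbalanced cycle. A barbell is the union of two edge-disjoint unbalanced cycles $C_1,C_2$ and a path $P$ such that either $C_1,C_2$ are vertex-disjoint and $P$ is internally vertex-disjoint from $C_1\cup C_2$ and shares an endvertex with each $C_i$, or $V(C_1)\cap V(C_2)=\{w\}$ and $P$ is the trivial path $w$. Two-terminal graphs $(G,s,t)$ have distinct terminals; series connection of $G_1,\dots,G_n$ identifies the target of $G_i$ with the source of $G_{i+1}$ ($i<n$), taking the source of $G_1$ and target of $G_n$ as terminals; parallel connection identifies all sources and all targets. Series-parallel graphs are obtained from copies of $K_2$ by iterated series and parallel connections. If $G$ is a series connection of series-parallel graphs $G_1,\dots,G_n$ ($n\ge 2$) with $n$ maximum, $G$ is of series type and $G_1,G_n$ are its endparts. -}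

module Defs where

open import Data.Nat using (ℕ; zero; suc; _+_; _≤_; _<_; _%_)
open import Data.Fin using (Fin; zero; suc; toℕ; inject₁; fromℕ)
open import Data.List using (List; []; _∷_; _++_; length; lookup; map; allFin)
open import Data.Nat.ListAction using (sum)
open import Data.Product using (_×_; _,_; Σ; ∃; ∃-syntax; proj₁; proj₂)
open import Data.Sum using (_⊎_)
open import Relation.Binary.PropositionalEquality using (_≡_; _≢_)
open import Relation.Nullary using (¬_)

-- Edges are identified by their index
--   in the list, so parallel edges are allowed.

data Sign : Set where
  pos neg : Sign

Edge : Set
Edge = ℕ × ℕ × Sign

SignedGraph : Set
SignedGraph = List Edge

EdgeId : SignedGraph → Set
EdgeId G = Fin (length G)

sign : Edge → Sign
sign (_ , _ , σ) = σ

Joins : Edge → ℕ → ℕ → Set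
Joins (u , v , _) x y = (u ≡ x × v ≡ y) ⊎ (u ≡ y × v ≡ x)

record Walk (G : SignedGraph) : Set where
  field
    len   : ℕ
    vert  : Fin (suc len) → ℕ
    edge  : Fin len → EdgeId G
    joins : (i : Fin len) → Joins (lookup G (edge i)) (vert (inject₁ i)) (vert (suc i))
open Walk public

IsPath : {G : SignedGraph} → Walk G → Set
IsPath W = (i j : Fin (suc (len W))) → vert W i ≡ vert W j → i ≡ j

IsCycle : {G : SignedGraph} → Walk G → Set
IsCycle W =
  (1 ≤ len W) ×
  (vert W (fromℕ (len W)) ≡ vert W zero) ×
  ((i j : Fin (len W)) → vert W (inject₁ i) ≡ vert W (inject₁ j) → i ≡ j) ×
  ((i j : Fin (len W)) → edge W i ≡ edge W j → i ≡ j)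

negVal : Sign → ℕ
negVal pos = 0
negVal neg = 1

negCount : {G : SignedGraph} → Walk G → ℕ
negCount {G} W = sum (map (λ i → negVal (sign (lookup G (edge W i)))) (allFin (len W)))

UnbalancedCycle : {G : SignedGraph} → Walk G → Set
UnbalancedCycle W = IsCycle W × (negCount W % 2 ≡ 1)

Unbalanced : SignedGraph → Set
Unbalanced G = Σ (Walk G) UnbalancedCycle

_∈V_ : {G : SignedGraph} → ℕ → Walk G → Set
x ∈V W = ∃[ i ] vert W i ≡ x

_∈E_ : {G : SignedGraph} → EdgeId G → Walk G → Set
e ∈E W = ∃[ i ] edge W i ≡ e

lastVert : {G : SignedGraph} → Walk G → ℕ
lastVert W = vert W (fromℕ (len W))

BarbellDisjoint : {G : SignedGraph} → Walk G → Walk G → Walk G → Set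
BarbellDisjoint C₁ C₂ P =
  ((x : ℕ) → x ∈V C₁ → ¬ (x ∈V C₂)) ×
  (vert P zero ∈V C₁) ×
  (lastVert P ∈V C₂) ×
  ((i : Fin (suc (len P))) → 0 < toℕ i → toℕ i < len P →
     ¬ (vert P i ∈V C₁) × ¬ (vert P i ∈V C₂))

BarbellTouching : {G : SignedGraph} → Walk G → Walk G → Walk G → Set
BarbellTouching C₁ C₂ P =
  Σ ℕ λ w →
    (w ∈V C₁) × (w ∈V C₂) ×
    ((x : ℕ) → x ∈V C₁ → x ∈V C₂ → x ≡ w) ×
    (len P ≡ 0) × (vert P zero ≡ w)

record Barbell (G : SignedGraph) : Set where
  field
    C₁ C₂ P     : Walk G
    C₁-unbal    : UnbalancedCycle C₁
    C₂-unbal    : UnbalancedCycle C₂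
    edgeDisj    : (i : Fin (len C₁)) (j : Fin (len C₂)) → edge C₁ i ≢ edge C₂ j
    P-path      : IsPath P
    shape       : BarbellDisjoint C₁ C₂ P ⊎ BarbellTouching C₁ C₂ P

_∈Barbell_ : {G : SignedGraph} → EdgeId G → Barbell G → Set
e ∈Barbell B = (e ∈E Barbell.C₁ B) ⊎ (e ∈E Barbell.C₂ B) ⊎ (e ∈E Barbell.P B)

InBarbell : (G : SignedGraph) → EdgeId G → Set
InBarbell G e = Σ (Barbell G) λ B → e ∈Barbell B

-- Signed two-terminal series-parallel graphs, as construction terms.
-- (Binary series/parallel connections generate the n-ary ones.)

data SP : Set where
  edgeSP : Sign → SP
  ser    : SP → SP → SP
  par    : SP → SP → SP

-- realise a term with source s, target t, fresh vertices from f;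
-- returns the edge list and the next fresh vertex
build : SP → ℕ → ℕ → ℕ → SignedGraph × ℕ
build (edgeSP σ) s t f = (s , t , σ) ∷ [] , f
build (ser A B) s t f =
  let rA = build A s f (suc f)
      rB = build B f t (proj₂ rA)
  in proj₁ rA ++ proj₁ rB , proj₂ rB
build (par A B) s t f =
  let rA = build A s t f
      rB = build B s t (proj₂ rA)
  in proj₁ rA ++ proj₁ rB , proj₂ rB

graph : SP → SignedGraph
graph T = proj₁ (build T 0 1 2)

-- Series type: the maximal series decomposition G₁ … G_n is obtained by
-- flattening nested series nodes; n ≥ 2 iff the top node is a series node.
data SeriesType : SP → Set where
  isSer : (A B : SP) → SeriesType (ser A B)

-- the endparts G₁ and G_n of the maximal series decomposition
firstPart : SP → SP
firstPart (ser A B) = firstPart A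
firstPart T = T

lastPart : SP → SP
lastPart (ser A B) = lastPart B
lastPart T = T

module Submission where

-- A series-parallel term is either balanced, in which case a switching
-- function shows that all its source–target paths have one parity, or
-- unbalanced, in which case every edge lies on a source–target path
-- avoiding any prescribed parity or on an unbalanced cycle with tails to
-- both terminals: in a parallel connection two paths of different parity
-- close up to an unbalanced cycle, and in a series connection paths and
-- tails are prolonged through the other part.
--
-- Write G' as the series connection of A and B.  As the first endpart of
-- A is unbalanced, every edge of A lies on a lollipop (an unbalanced
-- cycle plus a tail) inside A ending at the junction vertex: the cycle
-- comes from the first endpart, and the tail is prolonged through the
-- later series parts of A, through the given edge if necessary.  The same
-- holds for B, whose last endpart is unbalanced.  A and B meet only at the
-- junction, so a lollipop through the given edge on one side and any
-- lollipop on the other glue to a barbell.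

open import Defs
open import Data.Nat using (ℕ; zero; suc; _+_; _≤_; _<_; _%_; _≟_; _<?_; z≤n; s≤s; parity)
open import Data.Nat.Properties
  using (≤-refl; ≤-trans; <-trans; <-≤-trans; <-irrefl; <⇒≢; n<1+n; n≤1+n; m≤n⇒m≤1+n; ≮⇒≥; ≤-antisym;
         m<1+n⇒m≤n; m≤m+n; m<m+n; +-monoʳ-≤; +-monoʳ-<; +-assoc; +-comm; +-suc; +-identityʳ)
open import Data.Parity.Base using (Parity; 0ℙ; 1ℙ; _⁻¹) renaming (_+_ to _⊕_)
open import Data.Parity.Properties
  using (+-homo-+; p≢p⁻¹; p+p≡0ℙ; ⁻¹-involutive)
  renaming (+-comm to ⊕-comm; +-assoc to ⊕-assoc; +-identityʳ to ⊕-identityʳ)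
open import Data.Bool using (if_then_else_)
open import Function using (_∘_; id)
open import Data.Fin using (Fin; zero; suc; toℕ; inject₁; fromℕ)
open import Data.Fin.Properties using (toℕ-injective; toℕ-fromℕ; fromℕ≢inject₁; inject₁-injective; toℕ<n)
open import Data.List using (List; []; _∷_; _++_; length; lookup; tabulate)
open import Data.List.Properties using (map-tabulate; length-++)
open import Data.List.Relation.Unary.All as All using (All; []; _∷_)
import Data.List.Relation.Unary.All.Properties as All
open import Data.List.Membership.Propositional using (_∈_)
open import Data.List.Membership.Propositional.Properties using (∈-lookup; ∈-++⁺ˡ; ∈-++⁺ʳ; ∈-++⁻)
open import Data.List.Relation.Unary.Any using (here; there)
open import Data.List.Relation.Unary.Unique.Propositional using (Unique)
open import Data.List.Relation.Unary.AllPairs using ([]; _∷_)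
import Data.List.Relation.Unary.Unique.Propositional.Properties as Unique
open import Data.List.Relation.Binary.Disjoint.Propositional using (Disjoint)
open import Data.Nat.ListAction using (sum)
open import Data.Maybe using (Maybe; just; nothing; zipWith)
open import Data.Maybe.Relation.Unary.All using (just; nothing) renaming (All to AllMaybe)
open import Data.Product using (_×_; _,_; Σ; ∃; ∃-syntax; proj₁; proj₂)
open import Data.Sum using (_⊎_; inj₁; inj₂; [_,_]′)
open import Data.Empty using (⊥; ⊥-elim)
open import Relation.Binary.PropositionalEquality
  using (_≡_; _≢_; refl; sym; trans; cong; cong₂; subst; module ≡-Reasoning)
open import Relation.Nullary using (¬_; Dec; does; yes; no)
open import Relation.Nullary.Decidable using (dec-true; dec-false)

signParity : Sign → Parity
signParity σ = parity (negVal σ)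

parity≡1ℙ⇒%2≡1 : ∀ n → parity n ≡ 1ℙ → n % 2 ≡ 1
parity≡1ℙ⇒%2≡1 1 _ = refl
parity≡1ℙ⇒%2≡1 (suc (suc n)) h = parity≡1ℙ⇒%2≡1 n h

%2≡1⇒parity≡1ℙ : ∀ n → n % 2 ≡ 1 → parity n ≡ 1ℙ
%2≡1⇒parity≡1ℙ 1 _ = refl
%2≡1⇒parity≡1ℙ (suc (suc n)) h = %2≡1⇒parity≡1ℙ n h

⊕-telescope : ∀ a b c → (a ⊕ b) ⊕ (b ⊕ c) ≡ a ⊕ c
⊕-telescope 0ℙ 0ℙ c = refl
⊕-telescope 0ℙ 1ℙ 0ℙ = refl
⊕-telescope 0ℙ 1ℙ 1ℙ = refl
⊕-telescope 1ℙ 0ℙ 0ℙ = refl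
⊕-telescope 1ℙ 0ℙ 1ℙ = refl
⊕-telescope 1ℙ 1ℙ 0ℙ = refl
⊕-telescope 1ℙ 1ℙ 1ℙ = refl

⊕-shift-invariant : ∀ c a b → (c ⊕ a) ⊕ (c ⊕ b) ≡ a ⊕ b
⊕-shift-invariant 0ℙ a b = refl
⊕-shift-invariant 1ℙ 0ℙ b = ⁻¹-involutive b
⊕-shift-invariant 1ℙ 1ℙ b = refl

⊕-≡⇒≡⊕ʳ : ∀ a b q → a ⊕ b ≡ q → b ≡ a ⊕ q
⊕-≡⇒≡⊕ʳ a b _ refl = sym (trans (sym (⊕-assoc a a b)) (cong (_⊕ b) (p+p≡0ℙ a)))

⊕-≡⇒≡⊕ˡ : ∀ a b q → a ⊕ b ≡ q → a ≡ q ⊕ b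
⊕-≡⇒≡⊕ˡ a b q eq = trans (⊕-≡⇒≡⊕ʳ b a q (trans (⊕-comm b a) eq)) (⊕-comm b q)

⊕≡1ℙ : ∀ {a b} → a ≢ b → a ⊕ b ≡ 1ℙ
⊕≡1ℙ {0ℙ} {0ℙ} a≢b = ⊥-elim (a≢b refl)
⊕≡1ℙ {0ℙ} {1ℙ} _   = refl
⊕≡1ℙ {1ℙ} {0ℙ} _   = refl
⊕≡1ℙ {1ℙ} {1ℙ} a≢b = ⊥-elim (a≢b refl)

infix 4 _[_]=_

data _[_]=_ {A : Set} : List A → ℕ → A → Set where
  here  : ∀ {x xs} → (x ∷ xs) [ 0 ]= x
  there : ∀ {y xs k x} → xs [ k ]= x → (y ∷ xs) [ suc k ]= x

module _ {A : Set} where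

  []=-++⁺ˡ : ∀ {xs ys : List A} {k x} → xs [ k ]= x → (xs ++ ys) [ k ]= x
  []=-++⁺ˡ here      = here
  []=-++⁺ˡ (there p) = there ([]=-++⁺ˡ p)

  []=-++⁺ʳ : ∀ (xs : List A) {ys k x} → ys [ k ]= x → (xs ++ ys) [ length xs + k ]= x
  []=-++⁺ʳ []       p = p
  []=-++⁺ʳ (_ ∷ xs) p = there ([]=-++⁺ʳ xs p)

  []=⇒lookup : ∀ {xs : List A} {k x} → xs [ k ]= x →
               Σ (Fin (length xs)) λ i → toℕ i ≡ k × lookup xs i ≡ x
  []=⇒lookup here = zero , refl , refl
  []=⇒lookup (there p) with []=⇒lookup p
  ... | i , refl , q = suc i , refl , q

-- The s–t parity of a series-parallel term

parallelParity : Maybe Parity → Maybe Parity → Maybe Parity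
parallelParity (just 0ℙ) (just 0ℙ) = just 0ℙ
parallelParity (just 1ℙ) (just 1ℙ) = just 1ℙ
parallelParity _         _         = nothing

-- just p: the term is balanced and all its source–target paths have
-- parity p; nothing: the term is unbalanced.
stParity : SP → Maybe Parity
stParity (edgeSP σ) = just (signParity σ)
stParity (ser A B)  = zipWith _⊕_ (stParity A) (stParity B)
stParity (par A B)  = parallelParity (stParity A) (stParity B)

zipWith-⊕-just : ∀ x y {p} → zipWith _⊕_ x y ≡ just p →
                 ∃[ a ] ∃[ b ] x ≡ just a × y ≡ just b × p ≡ a ⊕ b
zipWith-⊕-just (just a) (just b) refl = a , b , refl , refl , refl

parallelParity-just : ∀ x y {p} → parallelParity x y ≡ just p → x ≡ just p × y ≡ just p
parallelParity-just (just 0ℙ) (just 0ℙ) refl = refl , refl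
parallelParity-just (just 1ℙ) (just 1ℙ) refl = refl , refl
parallelParity-just (just 0ℙ) (just 1ℙ) ()
parallelParity-just (just 1ℙ) (just 0ℙ) ()
parallelParity-just (just 0ℙ) nothing   ()
parallelParity-just (just 1ℙ) nothing   ()
parallelParity-just nothing   _         ()

zipWith-⊕-nothing : ∀ m n → zipWith _⊕_ m n ≡ nothing → m ≡ nothing ⊎ n ≡ nothing
zipWith-⊕-nothing nothing  _        _ = inj₁ refl
zipWith-⊕-nothing (just _) nothing  _ = inj₂ refl

parallelParity-just-just : ∀ {m n p} → m ≡ just p → n ≡ just p → parallelParity m n ≢ nothing
parallelParity-just-just {p = 0ℙ} refl refl ()
parallelParity-just-just {p = 1ℙ} refl refl ()

infix 4 _Admits_

_Admits_ : Maybe Parity → Parity → Set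
m Admits p = AllMaybe (_≡ p) m

admits-some : ∀ m → ∃ (m Admits_)
admits-some nothing  = 0ℙ , nothing
admits-some (just p) = p , just refl

admits-zipWith : ∀ {m n a b} → m Admits a → n Admits b → zipWith _⊕_ m n Admits (a ⊕ b)
admits-zipWith nothing     _           = nothing
admits-zipWith (just refl) nothing     = nothing
admits-zipWith (just refl) (just refl) = just refl

admits-zipWith⁻ : ∀ m n {b} → zipWith _⊕_ m n Admits b →
                  ∃[ a₁ ] ∃[ a₂ ] m Admits a₁ × n Admits a₂ × a₁ ⊕ a₂ ≡ b
admits-zipWith⁻ nothing n {b} _ with admits-some n
... | a₂ , n-a₂ = b ⊕ a₂ , a₂ , nothing , n-a₂ , ⊕-cancel b a₂
  where
    ⊕-cancel : ∀ x y → (x ⊕ y) ⊕ y ≡ x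
    ⊕-cancel x y = trans (⊕-assoc x y y) (trans (cong (x ⊕_) (p+p≡0ℙ y)) (⊕-identityʳ x))
admits-zipWith⁻ (just a) nothing {b} _ = a , a ⊕ b , just refl , nothing ,
  trans (sym (⊕-assoc a a b)) (cong (_⊕ b) (p+p≡0ℙ a))
admits-zipWith⁻ (just a₁) (just a₂) (just refl) = a₁ , a₂ , just refl , just refl , refl

admits-parallelˡ : ∀ m n {a} → m Admits a → parallelParity m n Admits a
admits-parallelˡ nothing   n         nothing     = nothing
admits-parallelˡ (just 0ℙ) nothing   (just refl) = nothing
admits-parallelˡ (just 1ℙ) nothing   (just refl) = nothing
admits-parallelˡ (just 0ℙ) (just 0ℙ) (just refl) = just refl
admits-parallelˡ (just 0ℙ) (just 1ℙ) (just refl) = nothing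
admits-parallelˡ (just 1ℙ) (just 0ℙ) (just refl) = nothing
admits-parallelˡ (just 1ℙ) (just 1ℙ) (just refl) = just refl

admits-parallelʳ : ∀ m n {a} → n Admits a → parallelParity m n Admits a
admits-parallelʳ nothing   n         _           = nothing
admits-parallelʳ (just 0ℙ) nothing   nothing     = nothing
admits-parallelʳ (just 1ℙ) nothing   nothing     = nothing
admits-parallelʳ (just 0ℙ) (just 0ℙ) (just refl) = just refl
admits-parallelʳ (just 0ℙ) (just 1ℙ) (just refl) = nothing
admits-parallelʳ (just 1ℙ) (just 0ℙ) (just refl) = nothing
admits-parallelʳ (just 1ℙ) (just 1ℙ) (just refl) = just refl

admits-parallel⁻ : ∀ m n {a} → parallelParity m n Admits a → m Admits a ⊎ n Admits a
admits-parallel⁻ nothing   _         _           = inj₁ nothing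
admits-parallel⁻ (just 0ℙ) nothing   _           = inj₂ nothing
admits-parallel⁻ (just 1ℙ) nothing   _           = inj₂ nothing
admits-parallel⁻ (just 0ℙ) (just 0ℙ) (just refl) = inj₁ (just refl)
admits-parallel⁻ (just 1ℙ) (just 1ℙ) (just refl) = inj₁ (just refl)
admits-parallel⁻ (just 0ℙ) (just 1ℙ) {0ℙ} _      = inj₁ (just refl)
admits-parallel⁻ (just 0ℙ) (just 1ℙ) {1ℙ} _      = inj₂ (just refl)
admits-parallel⁻ (just 1ℙ) (just 0ℙ) {0ℙ} _      = inj₂ (just refl)
admits-parallel⁻ (just 1ℙ) (just 0ℙ) {1ℙ} _      = inj₁ (just refl)

-- Vertex numbering of a realised term

edgesOf : SP → ℕ → ℕ → ℕ → SignedGraph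
edgesOf X s t f = proj₁ (build X s t f)

next : SP → ℕ → ℕ → ℕ → ℕ
next X s t f = proj₂ (build X s t f)

next-≥ : ∀ X s t f → f ≤ next X s t f
next-≥ (edgeSP σ) s t f = ≤-refl
next-≥ (ser A B)  s t f =
  ≤-trans (n≤1+n _) (≤-trans (next-≥ A s f (suc f)) (next-≥ B f t (next A s f (suc f))))
next-≥ (par A B)  s t f = ≤-trans (next-≥ A s t f) (next-≥ B s t (next A s t f))

WellPlaced : ℕ → ℕ → ℕ → Set
WellPlaced s t f = s ≢ t × s < f × t < f

WellPlaced-serˡ : ∀ {s t f} → WellPlaced s t f → WellPlaced s f (suc f)
WellPlaced-serˡ (_ , s<f , _) = <⇒≢ s<f , m≤n⇒m≤1+n s<f , n<1+n _

WellPlaced-serʳ : ∀ {s t f} r → suc f ≤ r → WellPlaced s t f → WellPlaced f t r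
WellPlaced-serʳ r f<r (_ , _ , t<f) = (λ f≡t → <⇒≢ t<f (sym f≡t)) , f<r , <-trans t<f (<-≤-trans (n<1+n _) f<r)

WellPlaced-parʳ : ∀ {s t f} r → f ≤ r → WellPlaced s t f → WellPlaced s t r
WellPlaced-parʳ r f≤r (s≢t , s<f , t<f) = s≢t , <-≤-trans s<f f≤r , <-≤-trans t<f f≤r

WellPlaced-root : WellPlaced 0 1 2
WellPlaced-root = (λ ()) , s≤s z≤n , s≤s (s≤s z≤n)

InRegion : ℕ → ℕ → ℕ → ℕ → ℕ → Set
InRegion s t lo hi x = x ≡ s ⊎ x ≡ t ⊎ (lo ≤ x × x < hi)

region : SP → ℕ → ℕ → ℕ → ℕ → Set
region X s t f = InRegion s t f (next X s t f)

data BothEnds (V : ℕ → Set) : Edge → Set where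
  ends : ∀ {u v σ} → V u → V v → BothEnds V (u , v , σ)

BothEnds-map : ∀ {V W : ℕ → Set} → (∀ {x} → V x → W x) → ∀ {e} → BothEnds V e → BothEnds W e
BothEnds-map h (ends hu hv) = ends (h hu) (h hv)

module _ (A B : SP) (s t f : ℕ) where

  private
    rA = next A s f (suc f)
    f<next : f < next B f t rA
    f<next = <-≤-trans (next-≥ A s f (suc f)) (next-≥ B f t rA)

  region-serˡ : ∀ {x} → region A s f (suc f) x → region (ser A B) s t f x
  region-serˡ (inj₁ e)                = inj₁ e
  region-serˡ (inj₂ (inj₁ refl))      = inj₂ (inj₂ (≤-refl , f<next))
  region-serˡ (inj₂ (inj₂ (lo , hi))) = inj₂ (inj₂ (≤-trans (n≤1+n f) lo , <-≤-trans hi (next-≥ B f t rA)))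

  region-serʳ : ∀ {x} → region B f t rA x → region (ser A B) s t f x
  region-serʳ (inj₁ refl)             = inj₂ (inj₂ (≤-refl , f<next))
  region-serʳ (inj₂ (inj₁ e))         = inj₂ (inj₁ e)
  region-serʳ (inj₂ (inj₂ (lo , hi))) = inj₂ (inj₂ (≤-trans (n≤1+n f) (≤-trans (next-≥ A s f (suc f)) lo) , hi))

  region-ser-∩ : WellPlaced s t f → ∀ {x} → region A s f (suc f) x → region B f t rA x → x ≡ f
  region-ser-∩ _ (inj₂ (inj₁ e)) _ = e
  region-ser-∩ _ _ (inj₁ e) = e
  region-ser-∩ (s≢t , _) (inj₁ refl) (inj₂ (inj₁ refl)) = ⊥-elim (s≢t refl)
  region-ser-∩ (_ , s<f , _) (inj₁ refl) (inj₂ (inj₂ (lo , _))) =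
    ⊥-elim (<-irrefl refl (<-≤-trans s<f (≤-trans (n≤1+n f) (≤-trans (next-≥ A s f (suc f)) lo))))
  region-ser-∩ (_ , _ , t<f) (inj₂ (inj₂ (lo , _))) (inj₂ (inj₁ refl)) = ⊥-elim (<-irrefl refl (<-trans t<f lo))
  region-ser-∩ _ (inj₂ (inj₂ (_ , hi))) (inj₂ (inj₂ (lo , _))) = ⊥-elim (<-irrefl refl (<-≤-trans hi lo))

module _ (A B : SP) (s t f : ℕ) where

  private
    rA = next A s t f

  region-parˡ : ∀ {x} → region A s t f x → region (par A B) s t f x
  region-parˡ (inj₁ e)                = inj₁ e
  region-parˡ (inj₂ (inj₁ e))         = inj₂ (inj₁ e)
  region-parˡ (inj₂ (inj₂ (lo , hi))) = inj₂ (inj₂ (lo , <-≤-trans hi (next-≥ B s t rA)))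

  region-parʳ : ∀ {x} → region B s t rA x → region (par A B) s t f x
  region-parʳ (inj₁ e)                = inj₁ e
  region-parʳ (inj₂ (inj₁ e))         = inj₂ (inj₁ e)
  region-parʳ (inj₂ (inj₂ (lo , hi))) = inj₂ (inj₂ (≤-trans (next-≥ A s t f) lo , hi))

  region-par-∩ : ∀ {x} → region A s t f x → region B s t rA x → x ≡ s ⊎ x ≡ t
  region-par-∩ (inj₁ e)              _                     = inj₁ e
  region-par-∩ (inj₂ (inj₁ e))       _                     = inj₂ e
  region-par-∩ _                     (inj₁ e)              = inj₁ e
  region-par-∩ _                     (inj₂ (inj₁ e))       = inj₂ e
  region-par-∩ (inj₂ (inj₂ (_ , hi))) (inj₂ (inj₂ (lo , _))) = ⊥-elim (<-irrefl refl (<-≤-trans hi lo))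

edges-inRegion : ∀ X s t f → All (BothEnds (region X s t f)) (edgesOf X s t f)
edges-inRegion (edgeSP σ) s t f = ends (inj₁ refl) (inj₂ (inj₁ refl)) ∷ []
edges-inRegion (ser A B) s t f =
  All.++⁺ (All.map (BothEnds-map (region-serˡ A B s t f)) (edges-inRegion A s f (suc f)))
          (All.map (BothEnds-map (region-serʳ A B s t f)) (edges-inRegion B f t (next A s f (suc f))))
edges-inRegion (par A B) s t f =
  All.++⁺ (All.map (BothEnds-map (region-parˡ A B s t f)) (edges-inRegion A s t f))
          (All.map (BothEnds-map (region-parʳ A B s t f)) (edges-inRegion B s t (next A s t f)))

InRange : ℕ → ℕ → ℕ → Set
InRange o n k = o ≤ k × k < o + n

module _ {A : Set} where

  InRange-++⁺ˡ : ∀ {o k} (xs ys : List A) → InRange o (length xs) k → InRange o (length (xs ++ ys)) k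
  InRange-++⁺ˡ {o} xs ys (lo , hi) =
    lo , <-≤-trans hi (+-monoʳ-≤ o (subst (length xs ≤_) (sym (length-++ xs)) (m≤m+n _ _)))

  InRange-++⁺ʳ : ∀ {o k} (xs ys : List A) → InRange (o + length xs) (length ys) k → InRange o (length (xs ++ ys)) k
  InRange-++⁺ʳ {o} {k} xs ys (lo , hi) =
    ≤-trans (m≤m+n o _) lo , subst (λ n → k < o + n) (sym (length-++ xs)) (subst (k <_) (+-assoc o _ _) hi)

  InRange-++⁻ : ∀ {o k} (xs ys : List A) → InRange o (length (xs ++ ys)) k →
                InRange o (length xs) k ⊎ InRange (o + length xs) (length ys) k
  InRange-++⁻ {o} {k} xs ys (lo , hi) with k <? o + length xs
  ... | yes k<o+m = inj₁ (lo , k<o+m)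
  ... | no  k≮o+m = inj₂ (≮⇒≥ k≮o+m ,
                          subst (k <_) (sym (+-assoc o _ _)) (subst (λ n → k < o + n) (length-++ xs) hi))

InRange-disjoint : ∀ {o m n k} → InRange o m k → InRange (o + m) n k → ⊥
InRange-disjoint (_ , hi) (lo , _) = <-irrefl refl (<-≤-trans hi lo)

InRange-single : ∀ {o k} → InRange o 1 k → k ≡ o + 0
InRange-single {o} {k} (lo , hi) =
  ≤-antisym (m<1+n⇒m≤n (subst (k <_) (+-suc o 0) hi)) (subst (_≤ k) (sym (+-identityʳ o)) lo)

-- Switching functions

data Consistent (π : ℕ → Parity) : Edge → Set where
  consistent : ∀ {u v σ} → signParity σ ≡ π u ⊕ π v → Consistent π (u , v , σ)

Consistent-Joins : ∀ {π e a b} → Consistent π e → Joins e a b → signParity (sign e) ≡ π a ⊕ π b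
Consistent-Joins             (consistent c) (inj₁ (refl , refl)) = c
Consistent-Joins {π} {a = a} (consistent c) (inj₂ (refl , refl)) = trans c (⊕-comm (π _) (π a))

sum-telescope : ∀ (π : ℕ → Parity) n (g : Fin n → ℕ) (v : Fin (suc n) → ℕ) →
                (∀ i → parity (g i) ≡ π (v (inject₁ i)) ⊕ π (v (suc i))) →
                parity (sum (tabulate g)) ≡ π (v zero) ⊕ π (v (fromℕ n))
sum-telescope π zero    g v h = sym (p+p≡0ℙ (π (v zero)))
sum-telescope π (suc n) g v h = begin
  parity (g zero + sum (tabulate (λ i → g (suc i))))
    ≡⟨ +-homo-+ (g zero) _ ⟩
  parity (g zero) ⊕ parity (sum (tabulate (λ i → g (suc i))))
    ≡⟨ cong₂ _⊕_ (h zero) (sum-telescope π n (λ i → g (suc i)) (λ i → v (suc i)) (λ i → h (suc i))) ⟩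
  (π (v zero) ⊕ π (v (suc zero))) ⊕ (π (v (suc zero)) ⊕ π (v (fromℕ (suc n))))
    ≡⟨ ⊕-telescope (π (v zero)) _ _ ⟩
  π (v zero) ⊕ π (v (fromℕ (suc n))) ∎
  where open ≡-Reasoning

negCount-switching : ∀ {G} π → All (Consistent π) G → (W : Walk G) →
              parity (negCount W) ≡ π (vert W zero) ⊕ π (lastVert W)
negCount-switching {G} π cons W =
  trans (cong (parity ∘ sum) (map-tabulate id count))
        (sum-telescope π (len W) count (vert W) λ i →
           Consistent-Joins (All.lookup cons (∈-lookup (edge W i))) (joins W i))
  where
    count = λ i → negVal (sign (lookup G (edge W i)))

switching⇒¬Unbalanced : ∀ {G} π → All (Consistent π) G → ¬ Unbalanced G
switching⇒¬Unbalanced π cons (W , (_ , closed , _) , odd) =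
  p≢p⁻¹ 0ℙ (begin
    0ℙ                                   ≡⟨ sym (p+p≡0ℙ (π (vert W zero))) ⟩
    π (vert W zero) ⊕ π (vert W zero)    ≡⟨ cong (λ x → π (vert W zero) ⊕ π x) (sym closed) ⟩
    π (vert W zero) ⊕ π (lastVert W)     ≡⟨ sym (negCount-switching π cons W) ⟩
    parity (negCount W)                  ≡⟨ %2≡1⇒parity≡1ℙ (negCount W) odd ⟩
    1ℙ                                   ∎)
  where open ≡-Reasoning

if-yes : ∀ {P A : Set} (P? : Dec P) {a b : A} → P → (if does P? then a else b) ≡ a
if-yes P? p rewrite dec-true P? p = refl

if-no : ∀ {P A : Set} (P? : Dec P) {a b : A} → ¬ P → (if does P? then a else b) ≡ b
if-no P? ¬p rewrite dec-false P? ¬p = refl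

Consistent-shift : ∀ {V : ℕ → Set} {π π′} c → (∀ {x} → V x → π x ≡ c ⊕ π′ x) →
                   ∀ {e} → BothEnds V e → Consistent π′ e → Consistent π e
Consistent-shift {π = π} {π′} c h (ends {u} {v} hu hv) (consistent k) = consistent (begin
  _                          ≡⟨ k ⟩
  π′ u ⊕ π′ v                ≡⟨ sym (⊕-shift-invariant c (π′ u) (π′ v)) ⟩
  (c ⊕ π′ u) ⊕ (c ⊕ π′ v)    ≡⟨ sym (cong₂ _⊕_ (h hu) (h hv)) ⟩
  π u ⊕ π v                  ∎)
  where open ≡-Reasoning

All-Consistent-shift : ∀ {V : ℕ → Set} {π π′} c → (∀ {x} → V x → π x ≡ c ⊕ π′ x) →
                       ∀ {es} → All (BothEnds V) es → All (Consistent π′) es → All (Consistent π) es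
All-Consistent-shift c h inV cons = All.zipWith (λ (r , k) → Consistent-shift c h r k) (inV , cons)

-- On a series connection the vertices of A are those below next A other
-- than t; on B the potential of B is shifted by the value at the junction f.
potential : SP → ℕ → ℕ → ℕ → ℕ → Parity
potential (edgeSP σ) s t f x = if does (x ≟ t) then signParity σ else 0ℙ
potential (par A B)  s t f x =
  if does (x <? next A s t f) then potential A s t f x else potential B s t (next A s t f) x
potential (ser A B)  s t f x =
  if does (x ≟ t) then πA f ⊕ πB x else if does (x <? rA) then πA x else πA f ⊕ πB x
  where
    rA = next A s f (suc f)
    πA = potential A s f (suc f)
    πB = potential B f t rA

record Switching (X : SP) (s t f : ℕ) (p : Parity) : Set where
  field
    at-source : potential X s t f s ≡ 0ℙ
    at-target : potential X s t f t ≡ p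
    on-edges  : All (Consistent (potential X s t f)) (edgesOf X s t f)

switching-par : ∀ A B {s t f p} → WellPlaced s t f →
                Switching A s t f p → Switching B s t (next A s t f) p → Switching (par A B) s t f p
switching-par A B {s} {t} {f} (_ , s<f , t<f) swA swB = record
  { at-source = trans (onA (inj₁ refl)) (Switching.at-source swA)
  ; at-target = trans (onA (inj₂ (inj₁ refl))) (Switching.at-target swA)
  ; on-edges  = All.++⁺ (All-Consistent-shift 0ℙ onA (edges-inRegion A s t f) (Switching.on-edges swA))
                        (All-Consistent-shift 0ℙ onB (edges-inRegion B s t rA) (Switching.on-edges swB))
  }
  where
    rA = next A s t f
    π = potential (par A B) s t f

    onA : ∀ {x} → region A s t f x → π x ≡ potential A s t f x
    onA {x} r = if-yes (x <? rA) (below r)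
      where
        below : region A s t f x → x < rA
        below (inj₁ refl)           = <-≤-trans s<f (next-≥ A s t f)
        below (inj₂ (inj₁ refl))    = <-≤-trans t<f (next-≥ A s t f)
        below (inj₂ (inj₂ (_ , hi))) = hi

    onB : ∀ {x} → region B s t rA x → π x ≡ potential B s t rA x
    onB (inj₁ refl) =
      trans (onA (inj₁ refl)) (trans (Switching.at-source swA) (sym (Switching.at-source swB)))
    onB (inj₂ (inj₁ refl)) =
      trans (onA (inj₂ (inj₁ refl))) (trans (Switching.at-target swA) (sym (Switching.at-target swB)))
    onB {x} (inj₂ (inj₂ (lo , _))) = if-no (x <? rA) λ x<rA → <-irrefl refl (<-≤-trans x<rA lo)

switching-ser : ∀ A B {s t f a b} → WellPlaced s t f →
                Switching A s f (suc f) a → Switching B f t (next A s f (suc f)) b →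
                Switching (ser A B) s t f (a ⊕ b)
switching-ser A B {s} {t} {f} (s≢t , s<f , t<f) swA swB = record
  { at-source = trans (onA (inj₁ refl)) (Switching.at-source swA)
  ; at-target = trans (if-yes (t ≟ t) refl)
                      (cong₂ _⊕_ (Switching.at-target swA) (Switching.at-target swB))
  ; on-edges  = All.++⁺ (All-Consistent-shift 0ℙ onA (edges-inRegion A s f (suc f)) (Switching.on-edges swA))
                        (All-Consistent-shift (πA f) onB (edges-inRegion B f t rA) (Switching.on-edges swB))
  }
  where
    rA = next A s f (suc f)
    πA = potential A s f (suc f)
    πB = potential B f t rA
    π = potential (ser A B) s t f
    f<rA : f < rA
    f<rA = next-≥ A s f (suc f)

    onA : ∀ {x} → region A s f (suc f) x → π x ≡ πA x
    onA {x} r = trans (if-no (x ≟ t) (≢t r)) (if-yes (x <? rA) (below r))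
      where
        ≢t : region A s f (suc f) x → x ≢ t
        ≢t (inj₁ refl)             = s≢t
        ≢t (inj₂ (inj₁ refl))      = λ f≡t → <-irrefl (sym f≡t) t<f
        ≢t (inj₂ (inj₂ (lo , _))) refl = <-irrefl refl (<-trans t<f lo)
        below : region A s f (suc f) x → x < rA
        below (inj₁ refl)            = <-trans s<f f<rA
        below (inj₂ (inj₁ refl))     = f<rA
        below (inj₂ (inj₂ (_ , hi))) = hi

    onB : ∀ {x} → region B f t rA x → π x ≡ πA f ⊕ πB x
    onB (inj₁ refl) = trans (onA (inj₂ (inj₁ refl)))
      (sym (trans (cong (πA f ⊕_) (Switching.at-source swB)) (⊕-identityʳ (πA f))))
    onB (inj₂ (inj₁ refl)) = if-yes (t ≟ t) refl
    onB {x} (inj₂ (inj₂ (lo , _))) =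
      trans (if-no (x ≟ t) λ { refl → <-irrefl refl (<-≤-trans (<-trans t<f f<rA) lo) })
            (if-no (x <? rA) λ x<rA → <-irrefl refl (<-≤-trans x<rA lo))

potential-switching : ∀ X {s t f p} → WellPlaced s t f → stParity X ≡ just p → Switching X s t f p
potential-switching (edgeSP σ) {s} {t} (s≢t , _) refl = record
  { at-source = if-no (s ≟ t) s≢t
  ; at-target = if-yes (t ≟ t) refl
  ; on-edges  = consistent (sym (cong₂ _⊕_ (if-no (s ≟ t) s≢t) (if-yes (t ≟ t) refl))) ∷ []
  }
potential-switching (par A B) {s} {t} {f} wp h
  with parallelParity-just (stParity A) (stParity B) h
... | hA , hB = switching-par A B wp (potential-switching A wp hA)
                  (potential-switching B (WellPlaced-parʳ _ (next-≥ A s t f) wp) hB)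
potential-switching (ser A B) {s} {t} {f} wp h
  with zipWith-⊕-just (stParity A) (stParity B) h
... | a , b , hA , hB , refl = switching-ser A B wp (potential-switching A (WellPlaced-serˡ wp) hA)
                                 (potential-switching B (WellPlaced-serʳ _ (next-≥ A s f (suc f)) wp) hB)

Unbalanced⇒stParity≡nothing : ∀ X → Unbalanced (graph X) → stParity X ≡ nothing
Unbalanced⇒stParity≡nothing X unbal with stParity X in eq
... | nothing = refl
... | just p  = ⊥-elim (switching⇒¬Unbalanced (potential X 0 1 2)
                  (Switching.on-edges (potential-switching X WellPlaced-root eq)) unbal)

-- Walks in a fixed signed graph

Joins-sym : ∀ e {u w} → Joins e u w → Joins e w u
Joins-sym (_ , _ , _) (inj₁ (p , q)) = inj₂ (p , q)
Joins-sym (_ , _ , _) (inj₂ (p , q)) = inj₁ (p , q)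

module InGraph (H : SignedGraph) where

  data _⇝_ : ℕ → ℕ → Set where
    []   : ∀ {u} → u ⇝ u
    step : ∀ {u w v e} k → H [ k ]= e → Joins e u w → w ⇝ v → u ⇝ v

  vertices : ∀ {u v} → u ⇝ v → List ℕ
  vertices {u} []               = u ∷ []
  vertices {u} (step _ _ _ w)   = u ∷ vertices w

  edgeIds : ∀ {u v} → u ⇝ v → List ℕ
  edgeIds []             = []
  edgeIds (step k _ _ w) = k ∷ edgeIds w

  walkParity : ∀ {u v} → u ⇝ v → Parity
  walkParity []                     = 0ℙ
  walkParity (step {e = e} _ _ _ w) = signParity (sign e) ⊕ walkParity w

  infixr 5 _++ʷ_

  _++ʷ_ : ∀ {u m v} → u ⇝ m → m ⇝ v → u ⇝ v
  []             ++ʷ q = q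
  step k a j p   ++ʷ q = step k a j (p ++ʷ q)

  reverse : ∀ {u v} → u ⇝ v → v ⇝ u
  reverse []                     = []
  reverse (step {e = e} k a j w) = reverse w ++ʷ step k a (Joins-sym e j) []

  source∈ : ∀ {u v} (w : u ⇝ v) → u ∈ vertices w
  source∈ []             = here refl
  source∈ (step _ _ _ w) = here refl

  target∈ : ∀ {u v} (w : u ⇝ v) → v ∈ vertices w
  target∈ []             = here refl
  target∈ (step _ _ _ w) = there (target∈ w)

  ∈-vertices-++⁻ : ∀ {u m v x} (p : u ⇝ m) (q : m ⇝ v) →
                   x ∈ vertices (p ++ʷ q) → x ∈ vertices p ⊎ x ∈ vertices q
  ∈-vertices-++⁻ []             q x∈ = inj₂ x∈
  ∈-vertices-++⁻ (step _ _ _ p) q (here e) = inj₁ (here e)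
  ∈-vertices-++⁻ (step _ _ _ p) q (there x∈) with ∈-vertices-++⁻ p q x∈
  ... | inj₁ x∈p = inj₁ (there x∈p)
  ... | inj₂ x∈q = inj₂ x∈q

  ∈-vertices-++⁺ˡ : ∀ {u m v x} (p : u ⇝ m) (q : m ⇝ v) → x ∈ vertices p → x ∈ vertices (p ++ʷ q)
  ∈-vertices-++⁺ˡ []             q (here refl) = source∈ q
  ∈-vertices-++⁺ˡ (step _ _ _ p) q (here e)    = here e
  ∈-vertices-++⁺ˡ (step _ _ _ p) q (there x∈)  = there (∈-vertices-++⁺ˡ p q x∈)

  edgeIds-++ : ∀ {u m v} (p : u ⇝ m) (q : m ⇝ v) → edgeIds (p ++ʷ q) ≡ edgeIds p ++ edgeIds q
  edgeIds-++ []             q = refl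
  edgeIds-++ (step k _ _ p) q = cong (k ∷_) (edgeIds-++ p q)

  ∈-edgeIds-++⁺ˡ : ∀ {u m v k} (p : u ⇝ m) (q : m ⇝ v) → k ∈ edgeIds p → k ∈ edgeIds (p ++ʷ q)
  ∈-edgeIds-++⁺ˡ p q k∈ = subst (_ ∈_) (sym (edgeIds-++ p q)) (∈-++⁺ˡ k∈)

  ∈-edgeIds-++⁺ʳ : ∀ {u m v k} (p : u ⇝ m) (q : m ⇝ v) → k ∈ edgeIds q → k ∈ edgeIds (p ++ʷ q)
  ∈-edgeIds-++⁺ʳ p q k∈ = subst (_ ∈_) (sym (edgeIds-++ p q)) (∈-++⁺ʳ (edgeIds p) k∈)

  ∈-edgeIds-++⁻ : ∀ {u m v k} (p : u ⇝ m) (q : m ⇝ v) → k ∈ edgeIds (p ++ʷ q) → k ∈ edgeIds p ⊎ k ∈ edgeIds q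
  ∈-edgeIds-++⁻ p q k∈ = ∈-++⁻ (edgeIds p) (subst (_ ∈_) (edgeIds-++ p q) k∈)

  walkParity-++ : ∀ {u m v} (p : u ⇝ m) (q : m ⇝ v) → walkParity (p ++ʷ q) ≡ walkParity p ⊕ walkParity q
  walkParity-++ []                     q = refl
  walkParity-++ (step {e = e} _ _ _ p) q =
    trans (cong (signParity (sign e) ⊕_) (walkParity-++ p q)) (sym (⊕-assoc (signParity (sign e)) _ _))

  Unique-edgeIds-++ : ∀ {u m v} (p : u ⇝ m) (q : m ⇝ v) → Unique (edgeIds p) → Unique (edgeIds q) →
                      Disjoint (edgeIds p) (edgeIds q) → Unique (edgeIds (p ++ʷ q))
  Unique-edgeIds-++ p q up uq d = subst Unique (sym (edgeIds-++ p q)) (Unique.++⁺ up uq d)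

  Unique-vertices-++ : ∀ {u m v} (p : u ⇝ m) (q : m ⇝ v) → Unique (vertices p) → Unique (vertices q) →
                       (∀ {x} → x ∈ vertices p → x ∈ vertices q → x ≡ m) → Unique (vertices (p ++ʷ q))
  Unique-vertices-++ []                 q _            uq _  = uq
  Unique-vertices-++ {u} (step _ _ _ p) q (u∉ ∷ up) uq only-m =
    All.¬Any⇒All¬ _ u∉p++q ∷ Unique-vertices-++ p q up uq (λ x∈p → only-m (there x∈p))
    where
      u∉p++q : ¬ u ∈ vertices (p ++ʷ q)
      u∉p++q u∈ with ∈-vertices-++⁻ p q u∈
      ... | inj₁ u∈p = All.All¬⇒¬Any u∉ u∈p
      ... | inj₂ u∈q with only-m (here refl) u∈q
      ... | refl = All.All¬⇒¬Any u∉ (target∈ p)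

  ∈-vertices-reverse⁻ : ∀ {u v x} (p : u ⇝ v) → x ∈ vertices (reverse p) → x ∈ vertices p
  ∈-vertices-reverse⁻ []                     x∈ = x∈
  ∈-vertices-reverse⁻ (step {e = e} k a j p) x∈ with ∈-vertices-++⁻ (reverse p) (step k a (Joins-sym e j) []) x∈
  ... | inj₁ x∈p                = there (∈-vertices-reverse⁻ p x∈p)
  ... | inj₂ (here refl)         = there (source∈ p)
  ... | inj₂ (there (here refl)) = here refl

  ∈-edgeIds-reverse⁻ : ∀ {u v k} (p : u ⇝ v) → k ∈ edgeIds (reverse p) → k ∈ edgeIds p
  ∈-edgeIds-reverse⁻ (step {e = e} k a j p) k∈ with ∈-edgeIds-++⁻ (reverse p) (step k a (Joins-sym e j) []) k∈
  ... | inj₁ k∈p       = there (∈-edgeIds-reverse⁻ p k∈p)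
  ... | inj₂ (here refl) = here refl

  ∈-edgeIds-reverse⁺ : ∀ {u v k} (p : u ⇝ v) → k ∈ edgeIds p → k ∈ edgeIds (reverse p)
  ∈-edgeIds-reverse⁺ (step {e = e} k a j p) (here refl) =
    ∈-edgeIds-++⁺ʳ (reverse p) (step k a (Joins-sym e j) []) (here refl)
  ∈-edgeIds-reverse⁺ (step {e = e} k a j p) (there k∈)  =
    ∈-edgeIds-++⁺ˡ (reverse p) (step k a (Joins-sym e j) []) (∈-edgeIds-reverse⁺ p k∈)

  Unique-edgeIds-reverse : ∀ {u v} (p : u ⇝ v) → Unique (edgeIds p) → Unique (edgeIds (reverse p))
  Unique-edgeIds-reverse []                     _         = []
  Unique-edgeIds-reverse (step {e = e} k a j p) (k∉ ∷ up) =
    Unique-edgeIds-++ (reverse p) (step k a (Joins-sym e j) []) (Unique-edgeIds-reverse p up) ([] ∷ [])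
      λ { (k∈p , here refl) → All.All¬⇒¬Any k∉ (∈-edgeIds-reverse⁻ p k∈p) }

  Unique-vertices-reverse : ∀ {u v} (p : u ⇝ v) → Unique (vertices p) → Unique (vertices (reverse p))
  Unique-vertices-reverse []                     up        = up
  Unique-vertices-reverse (step {e = e} k a j p) (u∉ ∷ up) =
    Unique-vertices-++ (reverse p) (step k a (Joins-sym e j) []) (Unique-vertices-reverse p up)
      (((λ { refl → All.All¬⇒¬Any u∉ (source∈ p) }) ∷ []) ∷ [] ∷ [])
      λ { _ (here refl) → refl
        ; x∈ (there (here refl)) → ⊥-elim (All.All¬⇒¬Any u∉ (∈-vertices-reverse⁻ p x∈)) }

  walkParity-reverse : ∀ {u v} (p : u ⇝ v) → walkParity (reverse p) ≡ walkParity p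
  walkParity-reverse []                     = refl
  walkParity-reverse (step {e = e} k a j p) = begin
    walkParity (reverse p ++ʷ step k a (Joins-sym e j) [])
      ≡⟨ walkParity-++ (reverse p) (step k a (Joins-sym e j) []) ⟩
    walkParity (reverse p) ⊕ (signParity (sign e) ⊕ 0ℙ)
      ≡⟨ cong₂ _⊕_ (walkParity-reverse p) (⊕-identityʳ _) ⟩
    walkParity p ⊕ signParity (sign e)
      ≡⟨ ⊕-comm (walkParity p) _ ⟩
    signParity (sign e) ⊕ walkParity p ∎
    where open ≡-Reasoning

  steps : ∀ {u v} → u ⇝ v → ℕ
  steps []             = 0
  steps (step _ _ _ w) = suc (steps w)

  vertexAt : ∀ {u v} (w : u ⇝ v) → Fin (suc (steps w)) → ℕ
  vertexAt {u} []             _       = u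
  vertexAt {u} (step _ _ _ w) zero    = u
  vertexAt     (step _ _ _ w) (suc i) = vertexAt w i

  edgeAt : ∀ {u v} (w : u ⇝ v) → Fin (steps w) → EdgeId H
  edgeAt (step k a j w) zero    = proj₁ ([]=⇒lookup a)
  edgeAt (step k a j w) (suc i) = edgeAt w i

  vertexAt-zero : ∀ {u v} (w : u ⇝ v) → vertexAt w zero ≡ u
  vertexAt-zero []             = refl
  vertexAt-zero (step _ _ _ w) = refl

  vertexAt-last : ∀ {u v} (w : u ⇝ v) → vertexAt w (fromℕ (steps w)) ≡ v
  vertexAt-last []             = refl
  vertexAt-last (step _ _ _ w) = vertexAt-last w

  edgeAt-joins : ∀ {u v} (w : u ⇝ v) (i : Fin (steps w)) →
                 Joins (lookup H (edgeAt w i)) (vertexAt w (inject₁ i)) (vertexAt w (suc i))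
  edgeAt-joins (step {u} {e = e} k a j w) zero =
    subst (λ e′ → Joins e′ u (vertexAt w zero)) (sym (proj₂ (proj₂ ([]=⇒lookup a))))
          (subst (Joins e u) (sym (vertexAt-zero w)) j)
  edgeAt-joins (step k a j w) (suc i) = edgeAt-joins w i

  toWalk : ∀ {u v} → u ⇝ v → Walk H
  toWalk w = record { len = steps w ; vert = vertexAt w ; edge = edgeAt w ; joins = edgeAt-joins w }

  vertexAt∈ : ∀ {u v} (w : u ⇝ v) i → vertexAt w i ∈ vertices w
  vertexAt∈ []             zero    = here refl
  vertexAt∈ (step _ _ _ w) zero    = here refl
  vertexAt∈ (step _ _ _ w) (suc i) = there (vertexAt∈ w i)

  ∈⇒∈V : ∀ {u v x} (w : u ⇝ v) → x ∈ vertices w → x ∈V toWalk w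
  ∈⇒∈V []             (here refl) = zero , refl
  ∈⇒∈V (step _ _ _ w) (here refl) = zero , refl
  ∈⇒∈V (step _ _ _ w) (there x∈) with ∈⇒∈V w x∈
  ... | i , eq = suc i , eq

  ∈V⇒∈ : ∀ {u v x} (w : u ⇝ v) → x ∈V toWalk w → x ∈ vertices w
  ∈V⇒∈ w (i , refl) = vertexAt∈ w i

  edgeAt∈ : ∀ {u v} (w : u ⇝ v) i → toℕ (edgeAt w i) ∈ edgeIds w
  edgeAt∈ (step k a j w) zero    = here (proj₁ (proj₂ ([]=⇒lookup a)))
  edgeAt∈ (step k a j w) (suc i) = there (edgeAt∈ w i)

  ∈⇒∈E : ∀ {u v} (w : u ⇝ v) (e : EdgeId H) → toℕ e ∈ edgeIds w → e ∈E toWalk w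
  ∈⇒∈E (step k a j w) e (here eq) = zero , toℕ-injective (trans (proj₁ (proj₂ ([]=⇒lookup a))) (sym eq))
  ∈⇒∈E (step k a j w) e (there e∈) with ∈⇒∈E w e e∈
  ... | i , eq = suc i , eq

  negCount-toWalk : ∀ {u v} (w : u ⇝ v) → parity (negCount (toWalk w)) ≡ walkParity w
  negCount-toWalk w = trans (cong (parity ∘ sum) (map-tabulate id (count w))) (go w)
    where
      count : ∀ {u v} (w : u ⇝ v) → Fin (steps w) → ℕ
      count w i = negVal (sign (lookup H (edgeAt w i)))
      go : ∀ {u v} (w : u ⇝ v) → parity (sum (tabulate (count w))) ≡ walkParity w
      go []                         = refl
      go (step {e = e} k a j w) with []=⇒lookup a
      ... | _ , _ , eq = trans (+-homo-+ (negVal (sign (lookup H _))) _)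
                               (cong₂ _⊕_ (cong (signParity ∘ sign) eq) (go w))

  Unique⇒IsPath : ∀ {u v} (w : u ⇝ v) → Unique (vertices w) → IsPath (toWalk w)
  Unique⇒IsPath []             _         zero    zero    _  = refl
  Unique⇒IsPath (step _ _ _ w) _         zero    zero    _  = refl
  Unique⇒IsPath (step _ _ _ w) (u∉ ∷ _)  zero    (suc j) eq =
    ⊥-elim (All.All¬⇒¬Any u∉ (subst (_∈ vertices w) (sym eq) (vertexAt∈ w j)))
  Unique⇒IsPath (step _ _ _ w) (u∉ ∷ _)  (suc i) zero    eq =
    ⊥-elim (All.All¬⇒¬Any u∉ (subst (_∈ vertices w) eq (vertexAt∈ w i)))
  Unique⇒IsPath (step _ _ _ w) (_ ∷ uw)  (suc i) (suc j) eq = cong suc (Unique⇒IsPath w uw i j eq)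

  edgeAt-injective : ∀ {u v} (w : u ⇝ v) → Unique (edgeIds w) → ∀ i j → edgeAt w i ≡ edgeAt w j → i ≡ j
  edgeAt-injective (step k a _ w) _         zero    zero    _  = refl
  edgeAt-injective (step k a _ w) (k∉ ∷ _)  zero    (suc j) eq = ⊥-elim (All.All¬⇒¬Any k∉
    (subst (_∈ edgeIds w) (trans (cong toℕ (sym eq)) (proj₁ (proj₂ ([]=⇒lookup a)))) (edgeAt∈ w j)))
  edgeAt-injective (step k a _ w) (k∉ ∷ _)  (suc i) zero    eq = ⊥-elim (All.All¬⇒¬Any k∉
    (subst (_∈ edgeIds w) (trans (cong toℕ eq) (proj₁ (proj₂ ([]=⇒lookup a)))) (edgeAt∈ w i)))
  edgeAt-injective (step k a _ w) (_ ∷ uw)  (suc i) (suc j) eq = cong suc (edgeAt-injective w uw i j eq)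

  IsCycleʷ : ∀ {c} → c ⇝ c → Set
  IsCycleʷ []             = ⊥
  IsCycleʷ (step k _ _ p) = Unique (vertices p) × Unique (k ∷ edgeIds p)

  IsCycleʷ⇒IsCycle : ∀ {c} (w : c ⇝ c) → IsCycleʷ w → IsCycle (toWalk w)
  IsCycleʷ⇒IsCycle (step k a j p) (up , ue) =
    s≤s z≤n , vertexAt-last p , distinct , edgeAt-injective (step k a j p) ue
    where
      distinct : ∀ i i′ → vertexAt (step k a j p) (inject₁ i) ≡ vertexAt (step k a j p) (inject₁ i′) → i ≡ i′
      distinct zero    zero     _  = refl
      distinct zero    (suc i′) eq =
        ⊥-elim (fromℕ≢inject₁ (Unique⇒IsPath p up _ _ (trans (vertexAt-last p) eq)))
      distinct (suc i) zero     eq =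
        ⊥-elim (fromℕ≢inject₁ (Unique⇒IsPath p up _ _ (trans (vertexAt-last p) (sym eq))))
      distinct (suc i) (suc i′) eq = cong suc (inject₁-injective (Unique⇒IsPath p up _ _ eq))

  IsCycleʷ-++ : ∀ {c m} (p : c ⇝ m) (q : m ⇝ c) → c ≢ m →
                Unique (vertices p) → Unique (vertices q) →
                (∀ {x} → x ∈ vertices p → x ∈ vertices q → x ≡ c ⊎ x ≡ m) →
                Unique (edgeIds p) → Unique (edgeIds q) → Disjoint (edgeIds p) (edgeIds q) →
                IsCycleʷ (p ++ʷ q)
  IsCycleʷ-++ [] q c≢m = ⊥-elim (c≢m refl)
  IsCycleʷ-++ (step k a j p) q _ (c∉ ∷ up) uq only-cm uep ueq disj =
    Unique-vertices-++ p q up uq only-m ,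
    subst (λ ks → Unique (k ∷ ks)) (sym (edgeIds-++ p q)) (Unique.++⁺ uep ueq disj)
    where
      only-m : ∀ {x} → x ∈ vertices p → x ∈ vertices q → x ≡ _
      only-m x∈p x∈q with only-cm (there x∈p) x∈q
      ... | inj₁ refl = ⊥-elim (All.All¬⇒¬Any c∉ x∈p)
      ... | inj₂ x≡m  = x≡m

  record Subregions (V E V₁ E₁ V₂ E₂ Shared : ℕ → Set) : Set where
    field
      V₁⊆V  : ∀ {x} → V₁ x → V x
      V₂⊆V  : ∀ {x} → V₂ x → V x
      E₁⊆E  : ∀ {k} → E₁ k → E k
      E₂⊆E  : ∀ {k} → E₂ k → E k
      V₁∩V₂ : ∀ {x} → V₁ x → V₂ x → Shared x
      E₁∩E₂ : ∀ {k} → E₁ k → E₂ k → ⊥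

  Subregions-swap : ∀ {V E V₁ E₁ V₂ E₂ S} → Subregions V E V₁ E₁ V₂ E₂ S → Subregions V E V₂ E₂ V₁ E₁ S
  Subregions-swap D = record
    { V₁⊆V = V₂⊆V ; V₂⊆V = V₁⊆V ; E₁⊆E = E₂⊆E ; E₂⊆E = E₁⊆E
    ; V₁∩V₂ = λ x₂ x₁ → V₁∩V₂ x₁ x₂ ; E₁∩E₂ = λ k₂ k₁ → E₁∩E₂ k₁ k₂ }
    where open Subregions D

  record Path (V E : ℕ → Set) (a b : ℕ) : Set where
    field
      walk            : a ⇝ b
      vertices-unique : Unique (vertices walk)
      vertices-in     : ∀ {x} → x ∈ vertices walk → V x
      edges-unique    : Unique (edgeIds walk)
      edges-in        : ∀ {k} → k ∈ edgeIds walk → E k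
  open Path

  pathParity : ∀ {V E a b} → Path V E a b → Parity
  pathParity P = walkParity (walk P)

  Path-weaken : ∀ {V E V′ E′ a b} → (∀ {x} → V x → V′ x) → (∀ {k} → E k → E′ k) → Path V E a b → Path V′ E′ a b
  Path-weaken hV hE P = record
    { walk = walk P ; vertices-unique = vertices-unique P ; vertices-in = hV ∘ vertices-in P
    ; edges-unique = edges-unique P ; edges-in = hE ∘ edges-in P }

  Path-reverse : ∀ {V E a b} → Path V E a b → Path V E b a
  Path-reverse P = record
    { walk            = reverse (walk P)
    ; vertices-unique = Unique-vertices-reverse (walk P) (vertices-unique P)
    ; vertices-in     = vertices-in P ∘ ∈-vertices-reverse⁻ (walk P)
    ; edges-unique    = Unique-edgeIds-reverse (walk P) (edges-unique P)
    ; edges-in        = edges-in P ∘ ∈-edgeIds-reverse⁻ (walk P) }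

  Path-++ : ∀ {V E V₁ E₁ V₂ E₂ a m b} → Subregions V E V₁ E₁ V₂ E₂ (_≡ m) →
            Path V₁ E₁ a m → Path V₂ E₂ m b → Path V E a b
  Path-++ D P Q = record
    { walk            = walk P ++ʷ walk Q
    ; vertices-unique = Unique-vertices-++ (walk P) (walk Q) (vertices-unique P) (vertices-unique Q)
                          λ x∈P x∈Q → V₁∩V₂ (vertices-in P x∈P) (vertices-in Q x∈Q)
    ; vertices-in     = [ V₁⊆V ∘ vertices-in P , V₂⊆V ∘ vertices-in Q ]′ ∘ ∈-vertices-++⁻ (walk P) (walk Q)
    ; edges-unique    = Unique-edgeIds-++ (walk P) (walk Q) (edges-unique P) (edges-unique Q)
                          λ (k∈P , k∈Q) → E₁∩E₂ (edges-in P k∈P) (edges-in Q k∈Q)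
    ; edges-in        = [ E₁⊆E ∘ edges-in P , E₂⊆E ∘ edges-in Q ]′ ∘ ∈-edgeIds-++⁻ (walk P) (walk Q) }
    where open Subregions D

  pathParity-++ : ∀ {V E V₁ E₁ V₂ E₂ a m b} (D : Subregions V E V₁ E₁ V₂ E₂ (_≡ m))
                  (P : Path V₁ E₁ a m) (Q : Path V₂ E₂ m b) →
                  pathParity (Path-++ D P Q) ≡ pathParity P ⊕ pathParity Q
  pathParity-++ D P Q = walkParity-++ (walk P) (walk Q)

  record UnbalancedCycleIn (V E : ℕ → Set) : Set where
    field
      base        : ℕ
      closed      : base ⇝ base
      is-cycle    : IsCycleʷ closed
      unbalanced  : walkParity closed ≡ 1ℙ
      vertices-in : ∀ {x} → x ∈ vertices closed → V x
      edges-in    : ∀ {k} → k ∈ edgeIds closed → E k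
  open UnbalancedCycleIn

  UnbalancedCycleIn-weaken : ∀ {V E V′ E′} → (∀ {x} → V x → V′ x) → (∀ {k} → E k → E′ k) →
                             UnbalancedCycleIn V E → UnbalancedCycleIn V′ E′
  UnbalancedCycleIn-weaken hV hE C = record
    { base = base C ; closed = closed C ; is-cycle = is-cycle C ; unbalanced = unbalanced C
    ; vertices-in = hV ∘ vertices-in C ; edges-in = hE ∘ edges-in C }

  cycle-from-paths : ∀ {V E V₁ E₁ V₂ E₂ s t} → Subregions V E V₁ E₁ V₂ E₂ (λ x → x ≡ s ⊎ x ≡ t) → s ≢ t →
                     (P : Path V₁ E₁ s t) (Q : Path V₂ E₂ s t) → pathParity P ≢ pathParity Q →
                     Σ (UnbalancedCycleIn V E) λ C →
                       (∀ {k} → k ∈ edgeIds (walk P) → k ∈ edgeIds (closed C)) ×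
                       s ∈ vertices (closed C) × t ∈ vertices (closed C)
  cycle-from-paths D s≢t P Q P≢Q = C , ∈-edgeIds-++⁺ˡ p (reverse q) , source∈ (p ++ʷ reverse q) ,
                                   ∈-vertices-++⁺ˡ p (reverse q) (target∈ p)
    where
      open Subregions D
      p = walk P
      q = walk Q
      C = record
        { base        = _
        ; closed      = p ++ʷ reverse q
        ; is-cycle    = IsCycleʷ-++ p (reverse q) s≢t (vertices-unique P)
                          (Unique-vertices-reverse q (vertices-unique Q))
                          (λ x∈p x∈q → V₁∩V₂ (vertices-in P x∈p) (vertices-in Q (∈-vertices-reverse⁻ q x∈q)))
                          (edges-unique P) (Unique-edgeIds-reverse q (edges-unique Q))
                          (λ (k∈p , k∈q) → E₁∩E₂ (edges-in P k∈p) (edges-in Q (∈-edgeIds-reverse⁻ q k∈q)))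
        ; unbalanced  = trans (walkParity-++ p (reverse q))
                          (trans (cong (walkParity p ⊕_) (walkParity-reverse q)) (⊕≡1ℙ P≢Q))
        ; vertices-in = [ V₁⊆V ∘ vertices-in P , V₂⊆V ∘ vertices-in Q ∘ ∈-vertices-reverse⁻ q ]′
                          ∘ ∈-vertices-++⁻ p (reverse q)
        ; edges-in    = [ E₁⊆E ∘ edges-in P , E₂⊆E ∘ edges-in Q ∘ ∈-edgeIds-reverse⁻ q ]′
                          ∘ ∈-edgeIds-++⁻ p (reverse q)
        }

  record Tail (V : ℕ → Set) {c} (C : c ⇝ c) (z : ℕ) : Set where
    field
      root        : ℕ
      stem        : root ⇝ z
      root∈       : root ∈ vertices C
      stem-unique : Unique (vertices stem)
      stem-in     : ∀ {x} → x ∈ vertices stem → V x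
      stem∩C      : ∀ {x} → x ∈ vertices stem → x ∈ vertices C → x ≡ root
  open Tail

  Tail-trivial : ∀ {V c z} {C : c ⇝ c} → V z → z ∈ vertices C → Tail V C z
  Tail-trivial Vz z∈C = record
    { root = _ ; stem = [] ; root∈ = z∈C ; stem-unique = [] ∷ []
    ; stem-in = λ { (here refl) → Vz } ; stem∩C = λ { (here refl) _ → refl } }

  Tail-weaken : ∀ {V V′ c z} {C : c ⇝ c} → (∀ {x} → V x → V′ x) → Tail V C z → Tail V′ C z
  Tail-weaken hV T = record
    { root = root T ; stem = stem T ; root∈ = root∈ T ; stem-unique = stem-unique T
    ; stem-in = hV ∘ stem-in T ; stem∩C = stem∩C T }

  Tail-extend : ∀ {V E V₁ E₁ V₂ E₂ c m z} {C : c ⇝ c} → Subregions V E V₁ E₁ V₂ E₂ (_≡ m) →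
                (∀ {x} → x ∈ vertices C → V₁ x) → Tail V₁ C m → Path V₂ E₂ m z → Tail V C z
  Tail-extend {C = C} D C-in T P = record
    { root        = root T
    ; stem        = stem T ++ʷ walk P
    ; root∈       = root∈ T
    ; stem-unique = Unique-vertices-++ (stem T) (walk P) (stem-unique T) (vertices-unique P)
                      λ x∈T x∈P → V₁∩V₂ (stem-in T x∈T) (vertices-in P x∈P)
    ; stem-in     = [ V₁⊆V ∘ stem-in T , V₂⊆V ∘ vertices-in P ]′ ∘ ∈-vertices-++⁻ (stem T) (walk P)
    ; stem∩C      = meets
    }
    where
      open Subregions D
      meets : ∀ {x} → x ∈ vertices (stem T ++ʷ walk P) → x ∈ vertices C → x ≡ root T
      meets x∈ x∈C with ∈-vertices-++⁻ (stem T) (walk P) x∈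
      ... | inj₁ x∈T = stem∩C T x∈T x∈C
      ... | inj₂ x∈P with V₁∩V₂ (C-in x∈C) (vertices-in P x∈P)
      ... | refl = stem∩C T (target∈ (stem T)) x∈C

  record Lollipop (V E : ℕ → Set) (z : ℕ) : Set where
    field
      cycle : UnbalancedCycleIn V E
      tail  : Tail V (closed cycle) z

  infix 4 _∈ᴸ_

  _∈ᴸ_ : ∀ {V E z} → ℕ → Lollipop V E z → Set
  k ∈ᴸ L = k ∈ edgeIds (closed (Lollipop.cycle L)) ⊎ k ∈ edgeIds (stem (Lollipop.tail L))

  Lollipop-extend : ∀ {V E V₁ E₁ V₂ E₂ m z} → Subregions V E V₁ E₁ V₂ E₂ (_≡ m) →
                    Lollipop V₁ E₁ m → Path V₂ E₂ m z → Lollipop V E z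
  Lollipop-extend D L P = record
    { cycle = UnbalancedCycleIn-weaken V₁⊆V E₁⊆E (Lollipop.cycle L)
    ; tail  = Tail-extend D (vertices-in (Lollipop.cycle L)) (Lollipop.tail L) P }
    where open Subregions D

  ∈ᴸ-extend⁺ˡ : ∀ {V E V₁ E₁ V₂ E₂ m z k} (D : Subregions V E V₁ E₁ V₂ E₂ (_≡ m)) L (P : Path V₂ E₂ m z) →
                k ∈ᴸ L → k ∈ᴸ Lollipop-extend D L P
  ∈ᴸ-extend⁺ˡ D L P = [ inj₁ , inj₂ ∘ ∈-edgeIds-++⁺ˡ (stem (Lollipop.tail L)) (walk P) ]′

  ∈ᴸ-extend⁺ʳ : ∀ {V E V₁ E₁ V₂ E₂ m z k} (D : Subregions V E V₁ E₁ V₂ E₂ (_≡ m)) L (P : Path V₂ E₂ m z) →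
                k ∈ edgeIds (walk P) → k ∈ᴸ Lollipop-extend D L P
  ∈ᴸ-extend⁺ʳ D L P = inj₂ ∘ ∈-edgeIds-++⁺ʳ (stem (Lollipop.tail L)) (walk P)

  record CycleWithTails (V E : ℕ → Set) (s t k : ℕ) : Set where
    field
      cycle   : UnbalancedCycleIn V E
      through : k ∈ edgeIds (closed cycle)
      to-s    : Tail V (closed cycle) s
      to-t    : Tail V (closed cycle) t

  CycleWithTails-weaken : ∀ {V E V′ E′ s t k} → (∀ {x} → V x → V′ x) → (∀ {k} → E k → E′ k) →
                          CycleWithTails V E s t k → CycleWithTails V′ E′ s t k
  CycleWithTails-weaken hV hE W = record
    { cycle = UnbalancedCycleIn-weaken hV hE cycle ; through = through
    ; to-s = Tail-weaken hV to-s ; to-t = Tail-weaken hV to-t }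
    where open CycleWithTails W

  cycleWithTails-from-paths : ∀ {V E V₁ E₁ V₂ E₂ s t k} →
                              Subregions V E V₁ E₁ V₂ E₂ (λ x → x ≡ s ⊎ x ≡ t) → s ≢ t →
                              (P : Path V₁ E₁ s t) → k ∈ edgeIds (walk P) → (Q : Path V₂ E₂ s t) →
                              pathParity P ≢ pathParity Q → CycleWithTails V E s t k
  cycleWithTails-from-paths D s≢t P k∈P Q P≢Q with cycle-from-paths D s≢t P Q P≢Q
  ... | C , P⊆C , s∈C , t∈C = record
    { cycle   = C
    ; through = P⊆C k∈P
    ; to-s    = Tail-trivial (UnbalancedCycleIn.vertices-in C s∈C) s∈C
    ; to-t    = Tail-trivial (UnbalancedCycleIn.vertices-in C t∈C) t∈C }

  -- Route k through side 1 and close up with a side-2 path of the other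
  -- parity; if side 1 has no fixed parity, recurse into it instead.
  parallel-cycle : ∀ {V E V₁ E₁ V₂ E₂ s t k} (m₁ m₂ : Maybe Parity) →
    Subregions V E V₁ E₁ V₂ E₂ (λ x → x ≡ s ⊎ x ≡ t) → s ≢ t →
    (Σ (Path V₁ E₁ s t) λ P → k ∈ edgeIds (walk P) × m₁ Admits pathParity P) →
    (m₁ ≡ nothing → ∀ q → (Σ (Path V₁ E₁ s t) λ P → k ∈ edgeIds (walk P) × pathParity P ≢ q)
                          ⊎ CycleWithTails V₁ E₁ s t k) →
    (∀ {p} → m₂ Admits p → Σ (Path V₂ E₂ s t) λ Q → pathParity Q ≡ p) →
    (∀ {p} → m₁ ≡ just p → m₂ ≢ just p) →
    CycleWithTails V E s t k
  parallel-cycle m₁ nothing D s≢t (P , k∈P , _) _ paths₂ _ with paths₂ {pathParity P ⁻¹} nothing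
  ... | Q , parQ = cycleWithTails-from-paths D s≢t P k∈P Q λ eq → p≢p⁻¹ _ (trans eq parQ)
  parallel-cycle (just p₁) (just p₂) D s≢t (P , k∈P , just refl) _ paths₂ differ with paths₂ (just refl)
  ... | Q , parQ = cycleWithTails-from-paths D s≢t P k∈P Q λ eq → differ refl (cong just (sym (trans eq parQ)))
  parallel-cycle nothing (just p₂) D s≢t _ recurse paths₂ _ with recurse refl p₂ | paths₂ (just refl)
  ... | inj₁ (P , k∈P , P≢p₂) | Q , parQ = cycleWithTails-from-paths D s≢t P k∈P Q λ eq → P≢p₂ (trans eq parQ)
  ... | inj₂ W                | _       = CycleWithTails-weaken V₁⊆V E₁⊆E W
    where open Subregions D

  off-parity-++ˡ : ∀ {V E V₁ E₁ V₂ E₂ a m b q} (D : Subregions V E V₁ E₁ V₂ E₂ (_≡ m))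
                   (P : Path V₁ E₁ a m) (Q : Path V₂ E₂ m b) →
                   pathParity P ≢ q ⊕ pathParity Q → pathParity (Path-++ D P Q) ≢ q
  off-parity-++ˡ {q = q} D P Q P≢ eq =
    P≢ (⊕-≡⇒≡⊕ˡ (pathParity P) (pathParity Q) q (trans (sym (pathParity-++ D P Q)) eq))

  off-parity-++ʳ : ∀ {V E V₁ E₁ V₂ E₂ a m b q} (D : Subregions V E V₁ E₁ V₂ E₂ (_≡ m))
                   (P : Path V₁ E₁ a m) (Q : Path V₂ E₂ m b) →
                   pathParity Q ≢ pathParity P ⊕ q → pathParity (Path-++ D P Q) ≢ q
  off-parity-++ʳ {q = q} D P Q Q≢ eq =
    Q≢ (⊕-≡⇒≡⊕ʳ (pathParity P) (pathParity Q) q (trans (sym (pathParity-++ D P Q)) eq))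

  CycleWithTails-extendʳ : ∀ {V E V₁ E₁ V₂ E₂ s m t k} → Subregions V E V₁ E₁ V₂ E₂ (_≡ m) →
                           CycleWithTails V₁ E₁ s m k → Path V₂ E₂ m t → CycleWithTails V E s t k
  CycleWithTails-extendʳ D W P = record
    { cycle = UnbalancedCycleIn-weaken V₁⊆V E₁⊆E cycle ; through = through
    ; to-s = Tail-weaken V₁⊆V to-s ; to-t = Tail-extend D (UnbalancedCycleIn.vertices-in cycle) to-t P }
    where open Subregions D
          open CycleWithTails W

  CycleWithTails-extendˡ : ∀ {V E V₁ E₁ V₂ E₂ s m t k} → Subregions V E V₁ E₁ V₂ E₂ (_≡ m) →
                           Path V₁ E₁ s m → CycleWithTails V₂ E₂ m t k → CycleWithTails V E s t k
  CycleWithTails-extendˡ D P W = record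
    { cycle = UnbalancedCycleIn-weaken V₂⊆V E₂⊆E cycle ; through = through
    ; to-s = Tail-extend (Subregions-swap D) (UnbalancedCycleIn.vertices-in cycle) to-s (Path-reverse P)
    ; to-t = Tail-weaken V₂⊆V to-t }
    where open Subregions D
          open CycleWithTails W

  UnbalancedCycleIn⇒UnbalancedCycle : ∀ {V E} (C : UnbalancedCycleIn V E) → UnbalancedCycle (toWalk (closed C))
  UnbalancedCycleIn⇒UnbalancedCycle C =
    IsCycleʷ⇒IsCycle (closed C) (is-cycle C) ,
    parity≡1ℙ⇒%2≡1 (negCount (toWalk (closed C))) (trans (negCount-toWalk (closed C)) (unbalanced C))

  trivial⊎≢ : ∀ {a b} (q : a ⇝ b) → Unique (vertices q) → (steps q ≡ 0 × a ≡ b) ⊎ a ≢ b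
  trivial⊎≢ []             _        = inj₁ (refl , refl)
  trivial⊎≢ (step _ _ _ q) (a∉ ∷ _) = inj₂ λ { refl → All.All¬⇒¬Any a∉ (target∈ q) }

  steps-++ : ∀ {u m v} (p : u ⇝ m) (q : m ⇝ v) → steps (p ++ʷ q) ≡ steps p + steps q
  steps-++ []             q = refl
  steps-++ (step _ _ _ p) q = cong suc (steps-++ p q)

  steps-reverse : ∀ {u v} (p : u ⇝ v) → steps (reverse p) ≡ steps p
  steps-reverse []                     = refl
  steps-reverse (step {e = e} k a j p) =
    trans (steps-++ (reverse p) (step k a (Joins-sym e j) []))
          (trans (cong (_+ 1) (steps-reverse p)) (+-comm (steps p) 1))

  barbell : ∀ {V E V₁ E₁ V₂ E₂ m} → Subregions V E V₁ E₁ V₂ E₂ (_≡ m) →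
            (L₁ : Lollipop V₁ E₁ m) (L₂ : Lollipop V₂ E₂ m) →
            Σ (Barbell H) λ B → ∀ e → toℕ e ∈ᴸ L₁ ⊎ toℕ e ∈ᴸ L₂ → e ∈Barbell B
  barbell {m = m} D L₁ L₂ = B , membership
    where
      open Subregions D
      U₁ = Lollipop.cycle L₁
      U₂ = Lollipop.cycle L₂
      T₁ = Lollipop.tail L₁
      T₂ = Lollipop.tail L₂
      C₁ = closed U₁
      C₂ = closed U₂
      Q₁ = stem T₁
      Q₂ = stem T₂
      a = root T₁
      b = root T₂
      Pw = Q₁ ++ʷ reverse Q₂

      Pw-unique : Unique (vertices Pw)
      Pw-unique = Unique-vertices-++ Q₁ (reverse Q₂) (stem-unique T₁)
        (Unique-vertices-reverse Q₂ (stem-unique T₂))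
        λ x∈Q₁ x∈Q₂ → V₁∩V₂ (stem-in T₁ x∈Q₁) (stem-in T₂ (∈-vertices-reverse⁻ Q₂ x∈Q₂))

      Pw-path : IsPath (toWalk Pw)
      Pw-path = Unique⇒IsPath Pw Pw-unique

      Pw∩C : ∀ {x} → x ∈ vertices Pw → (x ∈ vertices C₁ → x ≡ a) × (x ∈ vertices C₂ → x ≡ b)
      Pw∩C x∈ with ∈-vertices-++⁻ Q₁ (reverse Q₂) x∈
      ... | inj₁ x∈Q₁ = stem∩C T₁ x∈Q₁ , λ x∈C₂ → on-C₂ (V₁∩V₂ (stem-in T₁ x∈Q₁) (vertices-in U₂ x∈C₂)) x∈C₂
        where on-C₂ : ∀ {x} → x ≡ m → x ∈ vertices C₂ → x ≡ b
              on-C₂ refl = stem∩C T₂ (target∈ Q₂)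
      ... | inj₂ x∈Q₂ = (λ x∈C₁ → on-C₁ (V₁∩V₂ (vertices-in U₁ x∈C₁) (stem-in T₂ x∈Q₂′)) x∈C₁) ,
                        stem∩C T₂ x∈Q₂′
        where x∈Q₂′ = ∈-vertices-reverse⁻ Q₂ x∈Q₂
              on-C₁ : ∀ {x} → x ≡ m → x ∈ vertices C₁ → x ≡ a
              on-C₁ refl = stem∩C T₁ (target∈ Q₁)

      m∈Pw : m ∈ vertices Pw
      m∈Pw = ∈-vertices-++⁺ˡ Q₁ (reverse Q₂) (target∈ Q₁)

      disjoint : a ≢ m ⊎ b ≢ m → BarbellDisjoint (toWalk C₁) (toWalk C₂) (toWalk Pw)
      disjoint a≢m⊎b≢m =
        (λ x x∈C₁ x∈C₂ → apart (∈V⇒∈ C₁ x∈C₁) (∈V⇒∈ C₂ x∈C₂)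
                           (V₁∩V₂ (vertices-in U₁ (∈V⇒∈ C₁ x∈C₁)) (vertices-in U₂ (∈V⇒∈ C₂ x∈C₂)))) ,
        ∈⇒∈V C₁ (subst (_∈ vertices C₁) (sym (vertexAt-zero Pw)) (root∈ T₁)) ,
        ∈⇒∈V C₂ (subst (_∈ vertices C₂) (sym (vertexAt-last Pw)) (root∈ T₂)) ,
        interior
        where
          apart : ∀ {x} → x ∈ vertices C₁ → x ∈ vertices C₂ → x ≡ m → ⊥
          apart m∈C₁ m∈C₂ refl = [ (λ a≢m → a≢m (sym (proj₁ (Pw∩C m∈Pw) m∈C₁)))
                                 , (λ b≢m → b≢m (sym (proj₂ (Pw∩C m∈Pw) m∈C₂))) ]′ a≢m⊎b≢m
          interior : (i : Fin (suc (steps Pw))) → 0 < toℕ i → toℕ i < steps Pw →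
                     ¬ (vertexAt Pw i ∈V toWalk C₁) × ¬ (vertexAt Pw i ∈V toWalk C₂)
          interior i 0<i i<n =
            (λ x∈C₁ → ≢zero (Pw-path i zero
               (trans (proj₁ (Pw∩C (vertexAt∈ Pw i)) (∈V⇒∈ C₁ x∈C₁)) (sym (vertexAt-zero Pw))))) ,
            (λ x∈C₂ → ≢last (Pw-path i (fromℕ (steps Pw))
               (trans (proj₂ (Pw∩C (vertexAt∈ Pw i)) (∈V⇒∈ C₂ x∈C₂)) (sym (vertexAt-last Pw)))))
            where
              ≢zero : i ≢ zero
              ≢zero refl = <-irrefl refl 0<i
              ≢last : i ≢ fromℕ (steps Pw)
              ≢last refl = <-irrefl (toℕ-fromℕ (steps Pw)) i<n

      touching : steps Q₁ ≡ 0 → a ≡ m → steps Q₂ ≡ 0 → b ≡ m →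
                 BarbellTouching (toWalk C₁) (toWalk C₂) (toWalk Pw)
      touching n₁ refl n₂ refl =
        m , ∈⇒∈V C₁ (root∈ T₁) , ∈⇒∈V C₂ (root∈ T₂) ,
        (λ x x∈C₁ x∈C₂ → V₁∩V₂ (vertices-in U₁ (∈V⇒∈ C₁ x∈C₁)) (vertices-in U₂ (∈V⇒∈ C₂ x∈C₂))) ,
        trans (steps-++ Q₁ (reverse Q₂)) (cong₂ _+_ n₁ (trans (steps-reverse Q₂) n₂)) ,
        vertexAt-zero Pw

      shape : BarbellDisjoint (toWalk C₁) (toWalk C₂) (toWalk Pw) ⊎
              BarbellTouching (toWalk C₁) (toWalk C₂) (toWalk Pw)
      shape with trivial⊎≢ Q₁ (stem-unique T₁) | trivial⊎≢ Q₂ (stem-unique T₂)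
      ... | inj₂ a≢m         | _                = inj₁ (disjoint (inj₁ a≢m))
      ... | inj₁ _           | inj₂ b≢m         = inj₁ (disjoint (inj₂ b≢m))
      ... | inj₁ (n₁ , a≡m)  | inj₁ (n₂ , b≡m)  = inj₂ (touching n₁ a≡m n₂ b≡m)

      B : Barbell H
      B = record
        { C₁ = toWalk C₁ ; C₂ = toWalk C₂ ; P = toWalk Pw
        ; C₁-unbal = UnbalancedCycleIn⇒UnbalancedCycle U₁
        ; C₂-unbal = UnbalancedCycleIn⇒UnbalancedCycle U₂
        ; edgeDisj = λ i j eq → E₁∩E₂ (edges-in U₁ (edgeAt∈ C₁ i))
                                      (edges-in U₂ (subst (_∈ edgeIds C₂) (cong toℕ (sym eq)) (edgeAt∈ C₂ j)))
        ; P-path = Pw-path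
        ; shape = shape }

      membership : ∀ e → toℕ e ∈ᴸ L₁ ⊎ toℕ e ∈ᴸ L₂ → e ∈Barbell B
      membership e (inj₁ (inj₁ e∈C₁)) = inj₁ (∈⇒∈E C₁ e e∈C₁)
      membership e (inj₁ (inj₂ e∈Q₁)) = inj₂ (inj₂ (∈⇒∈E Pw e (∈-edgeIds-++⁺ˡ Q₁ (reverse Q₂) e∈Q₁)))
      membership e (inj₂ (inj₁ e∈C₂)) = inj₂ (inj₁ (∈⇒∈E C₂ e e∈C₂))
      membership e (inj₂ (inj₂ e∈Q₂)) =
        inj₂ (inj₂ (∈⇒∈E Pw e (∈-edgeIds-++⁺ʳ Q₁ (reverse Q₂) (∈-edgeIds-reverse⁺ Q₂ e∈Q₂))))

-- Subterms placed inside a graph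

length-edgesOf : ∀ X s t f → 0 < length (edgesOf X s t f)
length-edgesOf (edgeSP σ) s t f = s≤s z≤n
length-edgesOf (ser A B)  s t f =
  <-≤-trans (length-edgesOf A s f (suc f)) (subst (_ ≤_) (sym (length-++ (edgesOf A s f (suc f)))) (m≤m+n _ _))
length-edgesOf (par A B)  s t f =
  <-≤-trans (length-edgesOf A s t f) (subst (_ ≤_) (sym (length-++ (edgesOf A s t f))) (m≤m+n _ _))

module Placements (H : SignedGraph) where
  open InGraph H

  -- X realised in H with terminals s, t, fresh vertices from f, and its
  -- edges at the positions o, o + 1, … of H
  record Placement (X : SP) : Set where
    constructor placement
    field
      s t f o     : ℕ
      well-placed : WellPlaced s t f
      embed       : ∀ {j e} → edgesOf X s t f [ j ]= e → H [ o + j ]= e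

  module _ {X : SP} (c : Placement X) where
    open Placement c

    VertexIn : ℕ → Set
    VertexIn = region X s t f

    EdgeIn : ℕ → Set
    EdgeIn = InRange o (length (edgesOf X s t f))

    PathIn : Set
    PathIn = Path VertexIn EdgeIn s t

    CycleWithTailsIn : ℕ → Set
    CycleWithTailsIn = CycleWithTails VertexIn EdgeIn s t

    some-edge : ∃ EdgeIn
    some-edge = o , ≤-refl , m<m+n o (length-edgesOf X s t f)

  module _ {A B : SP} (c : Placement (ser A B)) where
    open Placement c

    serˡ : Placement A
    serˡ = placement s f (suc f) o (WellPlaced-serˡ well-placed) (embed ∘ []=-++⁺ˡ)

    serʳ : Placement B
    serʳ = placement f t (next A s f (suc f)) (o + length (edgesOf A s f (suc f)))
             (WellPlaced-serʳ _ (next-≥ A s f (suc f)) well-placed)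
             λ {j} {e} p → subst (H [_]= e) (sym (+-assoc o _ j)) (embed ([]=-++⁺ʳ (edgesOf A s f (suc f)) p))

    ser-subregions : Subregions (VertexIn c) (EdgeIn c) (VertexIn serˡ) (EdgeIn serˡ) (VertexIn serʳ) (EdgeIn serʳ)
                                (_≡ f)
    ser-subregions = record
      { V₁⊆V = region-serˡ A B s t f ; V₂⊆V = region-serʳ A B s t f
      ; E₁⊆E = InRange-++⁺ˡ (edgesOf A s f (suc f)) _ ; E₂⊆E = InRange-++⁺ʳ (edgesOf A s f (suc f)) _
      ; V₁∩V₂ = region-ser-∩ A B s t f well-placed ; E₁∩E₂ = InRange-disjoint }

    EdgeIn-ser⁻ : ∀ {k} → EdgeIn c k → EdgeIn serˡ k ⊎ EdgeIn serʳ k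
    EdgeIn-ser⁻ = InRange-++⁻ (edgesOf A s f (suc f)) _

  module _ {A B : SP} (c : Placement (par A B)) where
    open Placement c

    parˡ : Placement A
    parˡ = placement s t f o well-placed (embed ∘ []=-++⁺ˡ)

    parʳ : Placement B
    parʳ = placement s t (next A s t f) (o + length (edgesOf A s t f))
             (WellPlaced-parʳ _ (next-≥ A s t f) well-placed)
             λ {j} {e} p → subst (H [_]= e) (sym (+-assoc o _ j)) (embed ([]=-++⁺ʳ (edgesOf A s t f) p))

    par-subregions : Subregions (VertexIn c) (EdgeIn c) (VertexIn parˡ) (EdgeIn parˡ) (VertexIn parʳ) (EdgeIn parʳ)
                                (λ x → x ≡ s ⊎ x ≡ t)
    par-subregions = record
      { V₁⊆V = region-parˡ A B s t f ; V₂⊆V = region-parʳ A B s t f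
      ; E₁⊆E = InRange-++⁺ˡ (edgesOf A s t f) _ ; E₂⊆E = InRange-++⁺ʳ (edgesOf A s t f) _
      ; V₁∩V₂ = region-par-∩ A B s t f ; E₁∩E₂ = InRange-disjoint }

    EdgeIn-par⁻ : ∀ {k} → EdgeIn c k → EdgeIn parˡ k ⊎ EdgeIn parʳ k
    EdgeIn-par⁻ = InRange-++⁻ (edgesOf A s t f) _

  open Path

  edge-path : ∀ σ (c : Placement (edgeSP σ)) →
              Σ (PathIn c) λ P → pathParity P ≡ signParity σ × (∀ {k} → EdgeIn c k → k ∈ edgeIds (walk P))
  edge-path σ (placement s t f o (s≢t , _) embed) = P , ⊕-identityʳ (signParity σ) , here ∘ InRange-single
    where
      P = record
        { walk            = step (o + 0) (embed here) (inj₁ (refl , refl)) []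
        ; vertices-unique = (s≢t ∷ []) ∷ [] ∷ []
        ; vertices-in     = λ { (here refl) → inj₁ refl ; (there (here refl)) → inj₂ (inj₁ refl) }
        ; edges-unique    = [] ∷ []
        ; edges-in        = λ { (here refl) → m≤m+n o 0 , +-monoʳ-< o (s≤s z≤n) } }

  path-of-parity : ∀ X (c : Placement X) {p} → stParity X Admits p → Σ (PathIn c) λ P → pathParity P ≡ p
  path-of-parity (edgeSP σ) c (just refl) with edge-path σ c
  ... | P , parP , _ = P , parP
  path-of-parity (ser A B) c h with admits-zipWith⁻ (stParity A) (stParity B) h
  ... | a₁ , a₂ , hA , hB , refl with path-of-parity A (serˡ c) hA | path-of-parity B (serʳ c) hB
  ... | PA , refl | PB , refl = Path-++ (ser-subregions c) PA PB , pathParity-++ (ser-subregions c) PA PB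
  path-of-parity (par A B) c h with admits-parallel⁻ (stParity A) (stParity B) h
  ... | inj₁ hA = let PA , parA = path-of-parity A (parˡ c) hA in Path-weaken V₁⊆V E₁⊆E PA , parA
    where open Subregions (par-subregions c)
  ... | inj₂ hB = let PB , parB = path-of-parity B (parʳ c) hB in Path-weaken V₂⊆V E₂⊆E PB , parB
    where open Subregions (par-subregions c)

  path-through : ∀ X (c : Placement X) {k} → EdgeIn c k →
                 Σ (PathIn c) λ P → k ∈ edgeIds (walk P) × stParity X Admits pathParity P
  path-through (edgeSP σ) c k∈ with edge-path σ c
  ... | P , parP , through = P , through k∈ , just (sym parP)
  path-through (ser A B) c k∈ with EdgeIn-ser⁻ c k∈
  ... | inj₁ k∈A with path-through A (serˡ c) k∈A | admits-some (stParity B)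
  ... | PA , k∈PA , hA | b , hB with path-of-parity B (serʳ c) hB
  ... | PB , refl =
    Path-++ D PA PB , ∈-edgeIds-++⁺ˡ (walk PA) (walk PB) k∈PA ,
    subst (zipWith _⊕_ (stParity A) (stParity B) Admits_) (sym (pathParity-++ D PA PB)) (admits-zipWith hA hB)
    where D = ser-subregions c
  path-through (ser A B) c k∈ | inj₂ k∈B with path-through B (serʳ c) k∈B | admits-some (stParity A)
  ... | PB , k∈PB , hB | a , hA with path-of-parity A (serˡ c) hA
  ... | PA , refl =
    Path-++ D PA PB , ∈-edgeIds-++⁺ʳ (walk PA) (walk PB) k∈PB ,
    subst (zipWith _⊕_ (stParity A) (stParity B) Admits_) (sym (pathParity-++ D PA PB)) (admits-zipWith hA hB)
    where D = ser-subregions c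
  path-through (par A B) c k∈ with EdgeIn-par⁻ c k∈
  ... | inj₁ k∈A = let PA , k∈PA , hA = path-through A (parˡ c) k∈A
                   in Path-weaken V₁⊆V E₁⊆E PA , k∈PA , admits-parallelˡ (stParity A) (stParity B) hA
    where open Subregions (par-subregions c)
  ... | inj₂ k∈B = let PB , k∈PB , hB = path-through B (parʳ c) k∈B
                   in Path-weaken V₂⊆V E₂⊆E PB , k∈PB , admits-parallelʳ (stParity A) (stParity B) hB
    where open Subregions (par-subregions c)

  OffParityPath : ∀ {X} → Placement X → Parity → ℕ → Set
  OffParityPath c q k = Σ (PathIn c) λ P → k ∈ edgeIds (walk P) × pathParity P ≢ q

  -- The forbidden parity q is arbitrary so that, in a series connection, the
  -- path found in one part can be completed by any path of the other part.
  mutual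
    unbalanced-edge : ∀ X (c : Placement X) → stParity X ≡ nothing → ∀ q {k} → EdgeIn c k →
                      OffParityPath c q k ⊎ CycleWithTailsIn c k
    unbalanced-edge (par A B) c h q k∈ = inj₂ (parallel-cycleWithTails A B c h k∈)
    unbalanced-edge (ser A B) c h q k∈ with EdgeIn-ser⁻ c k∈
    ... | inj₁ k∈A = series-edgeˡ A B c h q k∈A
    ... | inj₂ k∈B = series-edgeʳ A B c h q k∈B

    parallel-cycleWithTails : ∀ A B (c : Placement (par A B)) → stParity (par A B) ≡ nothing →
                              ∀ {k} → EdgeIn c k → CycleWithTailsIn c k
    parallel-cycleWithTails A B c h k∈ with EdgeIn-par⁻ c k∈
    ... | inj₁ k∈A =
      parallel-cycle (stParity A) (stParity B) (par-subregions c) s≢t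
        (path-through A (parˡ c) k∈A) (λ hA q → unbalanced-edge A (parˡ c) hA q k∈A)
        (path-of-parity B (parʳ c)) (λ hA hB → parallelParity-just-just hA hB h)
      where s≢t = proj₁ (Placement.well-placed c)
    ... | inj₂ k∈B =
      parallel-cycle (stParity B) (stParity A) (Subregions-swap (par-subregions c)) s≢t
        (path-through B (parʳ c) k∈B) (λ hB q → unbalanced-edge B (parʳ c) hB q k∈B)
        (path-of-parity A (parˡ c)) (λ hB hA → parallelParity-just-just hA hB h)
      where s≢t = proj₁ (Placement.well-placed c)

    series-edgeˡ : ∀ A B (c : Placement (ser A B)) → stParity (ser A B) ≡ nothing →
                   ∀ q {k} → EdgeIn (serˡ c) k → OffParityPath c q k ⊎ CycleWithTailsIn c k
    series-edgeˡ A B c h q k∈A with zipWith-⊕-nothing (stParity A) (stParity B) h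
    ... | inj₂ hB with path-through A (serˡ c) k∈A
    ...   | PA , k∈PA , _
      with path-of-parity B (serʳ c) (subst (_Admits ((pathParity PA ⊕ q) ⁻¹)) (sym hB) nothing)
    ...   | PB , parPB =
      inj₁ (Path-++ D PA PB , ∈-edgeIds-++⁺ˡ (walk PA) (walk PB) k∈PA ,
            off-parity-++ʳ D PA PB λ eq → p≢p⁻¹ _ (sym (trans (sym parPB) eq)))
      where D = ser-subregions c
    series-edgeˡ A B c h q k∈A | inj₁ hA with path-of-parity B (serʳ c) (proj₂ (admits-some (stParity B)))
    ... | PB , _ with unbalanced-edge A (serˡ c) hA (q ⊕ pathParity PB) k∈A
    ...   | inj₁ (PA , k∈PA , PA≢) =
      inj₁ (Path-++ D PA PB , ∈-edgeIds-++⁺ˡ (walk PA) (walk PB) k∈PA , off-parity-++ˡ D PA PB PA≢)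
      where D = ser-subregions c
    ...   | inj₂ W = inj₂ (CycleWithTails-extendʳ (ser-subregions c) W PB)

    series-edgeʳ : ∀ A B (c : Placement (ser A B)) → stParity (ser A B) ≡ nothing →
                   ∀ q {k} → EdgeIn (serʳ c) k → OffParityPath c q k ⊎ CycleWithTailsIn c k
    series-edgeʳ A B c h q k∈B with zipWith-⊕-nothing (stParity A) (stParity B) h
    ... | inj₁ hA with path-through B (serʳ c) k∈B
    ...   | PB , k∈PB , _
      with path-of-parity A (serˡ c) (subst (_Admits ((q ⊕ pathParity PB) ⁻¹)) (sym hA) nothing)
    ...   | PA , parPA =
      inj₁ (Path-++ D PA PB , ∈-edgeIds-++⁺ʳ (walk PA) (walk PB) k∈PB ,
            off-parity-++ˡ D PA PB λ eq → p≢p⁻¹ _ (sym (trans (sym parPA) eq)))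
      where D = ser-subregions c
    series-edgeʳ A B c h q k∈B | inj₂ hB with path-of-parity A (serˡ c) (proj₂ (admits-some (stParity A)))
    ... | PA , _ with unbalanced-edge B (serʳ c) hB (pathParity PA ⊕ q) k∈B
    ...   | inj₁ (PB , k∈PB , PB≢) =
      inj₁ (Path-++ D PA PB , ∈-edgeIds-++⁺ʳ (walk PA) (walk PB) k∈PB , off-parity-++ʳ D PA PB PB≢)
      where D = ser-subregions c
    ...   | inj₂ W = inj₂ (CycleWithTails-extendˡ (ser-subregions c) PA W)

  lollipop-to-target : ∀ X (c : Placement X) → stParity (firstPart X) ≡ nothing →
                       ∀ {k} → EdgeIn c k → Σ (Lollipop (VertexIn c) (EdgeIn c) (Placement.t c)) (k ∈ᴸ_)
  lollipop-to-target (edgeSP σ) c () k∈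
  lollipop-to-target (par A B) c h k∈ =
    record { cycle = cycle ; tail = to-t } , inj₁ through
    where open CycleWithTails (parallel-cycleWithTails A B c h k∈)
  lollipop-to-target (ser A B) c h k∈ with EdgeIn-ser⁻ c k∈
  ... | inj₁ k∈A with lollipop-to-target A (serˡ c) h k∈A
                    | path-of-parity B (serʳ c) (proj₂ (admits-some (stParity B)))
  ...   | L , k∈L | PB , _ = Lollipop-extend D L PB , ∈ᴸ-extend⁺ˡ D L PB k∈L
    where D = ser-subregions c
  lollipop-to-target (ser A B) c h k∈ | inj₂ k∈B
    with lollipop-to-target A (serˡ c) h (proj₂ (some-edge (serˡ c))) | path-through B (serʳ c) k∈B
  ...   | L , _ | PB , k∈PB , _ = Lollipop-extend D L PB , ∈ᴸ-extend⁺ʳ D L PB k∈PB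
    where D = ser-subregions c

  lollipop-to-source : ∀ X (c : Placement X) → stParity (lastPart X) ≡ nothing →
                       ∀ {k} → EdgeIn c k → Σ (Lollipop (VertexIn c) (EdgeIn c) (Placement.s c)) (k ∈ᴸ_)
  lollipop-to-source (edgeSP σ) c () k∈
  lollipop-to-source (par A B) c h k∈ =
    record { cycle = cycle ; tail = to-s } , inj₁ through
    where open CycleWithTails (parallel-cycleWithTails A B c h k∈)
  lollipop-to-source (ser A B) c h k∈ with EdgeIn-ser⁻ c k∈
  ... | inj₂ k∈B with lollipop-to-source B (serʳ c) h k∈B
                    | path-of-parity A (serˡ c) (proj₂ (admits-some (stParity A)))
  ...   | L , k∈L | PA , _ = Lollipop-extend D L (Path-reverse PA) , ∈ᴸ-extend⁺ˡ D L (Path-reverse PA) k∈L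
    where D = Subregions-swap (ser-subregions c)
  lollipop-to-source (ser A B) c h k∈ | inj₁ k∈A
    with lollipop-to-source B (serʳ c) h (proj₂ (some-edge (serʳ c))) | path-through A (serˡ c) k∈A
  ...   | L , _ | PA , k∈PA , _ =
    Lollipop-extend D L (Path-reverse PA) , ∈ᴸ-extend⁺ʳ D L (Path-reverse PA) (∈-edgeIds-reverse⁺ (walk PA) k∈PA)
    where D = Subregions-swap (ser-subregions c)

  series-barbell : ∀ A B (c : Placement (ser A B)) →
                   stParity (firstPart A) ≡ nothing → stParity (lastPart B) ≡ nothing →
                   ∀ e → EdgeIn c (toℕ e) → InBarbell H e
  series-barbell A B c hA hB e e∈ with EdgeIn-ser⁻ c e∈
  ... | inj₁ e∈A with lollipop-to-target A (serˡ c) hA e∈A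
                    | lollipop-to-source B (serʳ c) hB (proj₂ (some-edge (serʳ c)))
  ...   | L₁ , e∈L₁ | L₂ , _ = let Bb , mem = barbell (ser-subregions c) L₁ L₂ in Bb , mem e (inj₁ e∈L₁)
  series-barbell A B c hA hB e e∈ | inj₂ e∈B
    with lollipop-to-target A (serˡ c) hA (proj₂ (some-edge (serˡ c))) | lollipop-to-source B (serʳ c) hB e∈B
  ...   | L₁ , _ | L₂ , e∈L₂ = let Bb , mem = barbell (ser-subregions c) L₁ L₂ in Bb , mem e (inj₂ e∈L₂)

lemma9 : (T : SP) → SeriesType T →
         Unbalanced (graph (firstPart T)) →
         Unbalanced (graph (lastPart T)) →
         (e : EdgeId (graph T)) → InBarbell (graph T) e
lemma9 .(ser A B) (isSer A B) unbalancedᶠ unbalancedˡ e =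
  series-barbell A B (placement 0 1 2 0 WellPlaced-root id)
    (Unbalanced⇒stParity≡nothing (firstPart A) unbalancedᶠ)
    (Unbalanced⇒stParity≡nothing (lastPart B) unbalancedˡ)
    e (z≤n , toℕ<n e)
  where open Placements (graph (ser A B))
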